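{- Let $G$ and $H$ be disjoint simple cubic graphs, $x \in V(G)$, $y\in V(H)$, and let $G \equiv H$ be the graph obtained from the disjoint union of $G-x$ and $H-y$ by adding three edges that join the three neighbours of $x$ in $G$ bijectively (via an arbitrary bijection) to the three neighbours of $y$ in $H$. Then $$c(G \equiv H) = c(G) + c(H) - 3.$$
   Context: A cycle is a connected $2$-regular graph. A cycle double cover (CDC) of a graph $G$ is a multiset of cycles of $G$ such that every edge lies in exactly two members, counted with multiplicity; its size is the number of cycles with multiplicity. $c(G)$ is the minimum size of a CDC of $G$, with $c(G)=\infty$ if $G$ has no CDC (and $\infty$ plus or minus a finite number is $\infty$). -}

module Defs where

open import Data.Nat using (ℕ; zero; suc; _+_; _∸_; _≤_)
open import Data.Fin using (Fin; punchIn; splitAt; _≟_)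
open import Data.Fin.Subset using (∣_∣)
open import Data.Vec using (tabulate)
open import Data.Bool using (Bool; true; false; _∧_; if_then_else_)
open import Data.Bool.Properties using (∧-comm)
open import Data.List using (List; []; _∷_; map; length)
open import Data.Maybe using (Maybe; just; nothing)
open import Data.Sum using (_⊎_; inj₁; inj₂)
open import Data.Product using (Σ; ∃; _×_; _,_)
open import Relation.Nullary using (¬_; does)
open import Relation.Binary.PropositionalEquality using (_≡_; refl; cong₂; trans)
open import Relation.Binary.Construct.Closure.ReflexiveTransitive using (Star)

record Graph (n : ℕ) : Set where
  field
    adj    : Fin n → Fin n → Bool
    sym    : ∀ u v → adj u v ≡ adj v u
    irrefl : ∀ v → adj v v ≡ false
open Graph public

deg : ∀ {n} → (Fin n → Bool) → ℕ
deg f = ∣ tabulate f ∣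

Cubic : ∀ {n} → Graph n → Set
Cubic {n} G = ∀ (v : Fin n) → deg (adj G v) ≡ 3

-- A cycle of G: a subgraph of G (given by its edge set E; its vertex set is the
-- set of vertices incident with an edge of E) which is 2-regular and connected
-- (and non-empty).
record Cycle {n : ℕ} (G : Graph n) : Set where
  field
    E         : Fin n → Fin n → Bool
    E-sym     : ∀ u v → E u v ≡ E v u
    E⊆G       : ∀ u v → E u v ≡ true → adj G u v ≡ true
    two-reg   : ∀ v → deg (E v) ≡ 0 ⊎ deg (E v) ≡ 2
    nonempty  : ∃ λ v → deg (E v) ≡ 2
    connected : ∀ u v → deg (E u) ≡ 2 → deg (E v) ≡ 2 →
                Star (λ a b → E a b ≡ true) u v
open Cycle public

countTrue : List Bool → ℕ
countTrue [] = 0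
countTrue (true ∷ bs) = suc (countTrue bs)
countTrue (false ∷ bs) = countTrue bs

IsCDC : ∀ {n} (G : Graph n) → List (Cycle G) → Set
IsCDC {n} G L = ∀ (u v : Fin n) → adj G u v ≡ true → countTrue (map (λ C → E C u v) L) ≡ 2

-- ℕ ∪ {∞}, with nothing = ∞
ℕ∞ : Set
ℕ∞ = Maybe ℕ

_+∞_ : ℕ∞ → ℕ∞ → ℕ∞
just a +∞ just b = just (a + b)
_ +∞ _ = nothing

_∸∞_ : ℕ∞ → ℕ → ℕ∞
just a ∸∞ k = just (a ∸ k)
nothing ∸∞ k = nothing

CDCNumber : ∀ {n} → Graph n → ℕ∞ → Set
CDCNumber G nothing  = ¬ (Σ (List (Cycle G)) (IsCDC G))
CDCNumber G (just k) =
  (Σ (List (Cycle G)) λ L → IsCDC G L × length L ≡ k) ×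
  (∀ L → IsCDC G L → k ≤ length L)

IsNbrBijection : ∀ {m n} (G : Graph m) (H : Graph n) (x : Fin m) (y : Fin n)
                 (f : Fin m → Fin n) → Set
IsNbrBijection {m} {n} G H x y f =
  (∀ u → adj G x u ≡ true → adj H y (f u) ≡ true) ×
  (∀ u u' → adj G x u ≡ true → adj G x u' ≡ true → f u ≡ f u' → u ≡ u') ×
  (∀ w → adj H y w ≡ true → ∃ λ u → adj G x u ≡ true × f u ≡ w)

-- The graph G ≡ H: vertices of G - x are  Fin m  (via punchIn x), vertices of
-- H - y are  Fin n  (via punchIn y); the disjoint union is Fin m ⊎ Fin n,
-- identified with Fin (m + n) via splitAt.
module _ {m n : ℕ} (G : Graph (suc m)) (H : Graph (suc n))
         (x : Fin (suc m)) (y : Fin (suc n)) (f : Fin (suc m) → Fin (suc n)) where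

  cross : Fin m → Fin n → Bool
  cross a b = adj G x (punchIn x a) ∧ (adj H y (punchIn y b) ∧ does (f (punchIn x a) ≟ punchIn y b))

  adj⊎ : Fin m ⊎ Fin n → Fin m ⊎ Fin n → Bool
  adj⊎ (inj₁ a) (inj₁ a') = adj G (punchIn x a) (punchIn x a')
  adj⊎ (inj₂ b) (inj₂ b') = adj H (punchIn y b) (punchIn y b')
  adj⊎ (inj₁ a) (inj₂ b)  = cross a b
  adj⊎ (inj₂ b) (inj₁ a)  = cross a b

  adj⊎-sym : ∀ p q → adj⊎ p q ≡ adj⊎ q p
  adj⊎-sym (inj₁ a) (inj₁ a') = sym G _ _
  adj⊎-sym (inj₂ b) (inj₂ b') = sym H _ _
  adj⊎-sym (inj₁ a) (inj₂ b)  = refl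
  adj⊎-sym (inj₂ b) (inj₁ a)  = refl

  adj⊎-irrefl : ∀ p → adj⊎ p p ≡ false
  adj⊎-irrefl (inj₁ a) = irrefl G _
  adj⊎-irrefl (inj₂ b) = irrefl H _

  join3 : Graph (m + n)
  join3 = record
    { adj    = λ u v → adj⊎ (splitAt m u) (splitAt m v)
    ; sym    = λ u v → adj⊎-sym (splitAt m u) (splitAt m v)
    ; irrefl = λ v → adj⊎-irrefl (splitAt m v)
    }

{-# OPTIONS --safe #-}
-- Every edge at a vertex x of degree three lies in exactly two cycles of a CDC of G, so exactly three
-- cycles pass through x and each of them avoids a different edge at x; likewise at y in H.
-- c(G ≡ H) ≤ c(G) + c(H) − 3: glue the cycle of G avoiding an edge at x to the cycle of H avoiding the
-- matching edge at y (a cycle minus a vertex is still connected, by a parity argument) and keep all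
-- other cycles.
-- c(G) + c(H) − 3 ≤ c(G ≡ H): contracting the H-side of each cycle of a CDC of G ≡ H to x gives a cycle
-- of G, because the number of crossing edges is even (handshake lemma) and at most 3; symmetrically for H.
-- This yields CDCs of G and H in which only the crossing cycles are counted twice, and these become
-- the three cycles through x.

module Submission where

open import Defs renaming (sym to adj-sym)
import Algebra.Properties.CommutativeMonoid.Sum as Sum
import Algebra.Properties.CommutativeSemigroup as CommutativeSemigroup
open import Data.Bool using (Bool; true; false; _∧_; _∨_; not) renaming (_≟_ to _≟ᵇ_)
open import Data.Bool.Properties
  using (¬-not; not-injective; ∧-comm; ∧-zeroʳ; ∧-identityʳ; ∧-conicalˡ; ∧-conicalʳ; ∨-zeroʳ)
open import Data.Empty using (⊥; ⊥-elim)
open import Data.Fin using (Fin; zero; suc; punchIn; punchOut; splitAt; join; _↑ˡ_; _↑ʳ_; _≟_)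
open import Data.Fin.Properties
  using (any?; 0≢1+n; punchInᵢ≢i; punchIn-injective; punchIn-punchOut; punchOut-punchIn; punchOut-cong;
         splitAt-join; join-splitAt; splitAt-↑ˡ; splitAt-↑ʳ)
  renaming (suc-injective to Fin-suc-injective)
open import Data.Fin.Subset.Properties using (∣p∣≤n)
open import Data.List using (List; []; _∷_; map; length; _++_; mapMaybe)
import Data.List as List
open import Data.List.Properties using (map-∘; length-++; length-map; length-tabulate)
open import Data.Maybe using (Maybe; just; nothing; maybe; is-just)
open import Data.Nat using (ℕ; zero; suc; _+_; _∸_; _≤_; _<_; _≤?_; z≤n; s≤s) renaming (_≟_ to _≟ℕ_)
open import Data.Nat.Divisibility using (_∣_; divides; _∣0; ∣m∣n⇒∣m+n; ∣m+n∣m⇒∣n; ∣⇒≤)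
open import Data.Nat.Properties
  using (+-0-commutativeMonoid; +-commutativeSemigroup; +-comm; +-assoc; +-identityʳ; +-suc; *-comm; suc-injective;
         +-cancelˡ-≡; +-cancelʳ-≡; +-mono-≤; ≤-trans; ≤-reflexive; <-irrefl; ≰⇒>; m+n≡0⇒m≡0; m+n≡0⇒n≡0;
         m+n∸n≡m; m≤n+o⇒m∸n≤o)
open import Data.Product using (Σ; ∃; _×_; _,_; proj₁; proj₂)
open import Data.Sum using (_⊎_; inj₁; inj₂; swap)
open import Data.Sum.Properties using (swap-involutive)
open import Data.Vec using (tabulate)
open import Data.Vec.Functional using () renaming (_∷_ to _◂_)
open import Function using (_∘_; const; case_of_; Injective)
open import Relation.Binary.Construct.Closure.ReflexiveTransitive using (Star; ε; _◅_; _◅◅_; gmap; concat; reverse)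
import Relation.Binary.Construct.Closure.ReflexiveTransitive as RTC
open import Relation.Binary.PropositionalEquality
  using (_≡_; _≢_; _≗_; refl; sym; trans; cong; cong₂; subst; subst₂; module ≡-Reasoning)
open import Relation.Nullary using (¬_; Dec; does; yes; no)
open import Relation.Nullary.Decidable using (dec-true; dec-false)

open Sum +-0-commutativeMonoid using (sum-syntax; sum-cong-≗; sum-remove; sum-replicate-zero; ∑-distrib-+)
open CommutativeSemigroup +-commutativeSemigroup using (interchange)
open ≡-Reasoning

does⇒ : ∀ {P : Set} (d : Dec P) → does d ≡ true → P
does⇒ (yes p) _ = p

bit : Bool → ℕ
bit false = 0
bit true  = 1

_⊆_ : ∀ {N} → (Fin N → Bool) → (Fin N → Bool) → Set
f ⊆ g = ∀ v → f v ≡ true → g v ≡ true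

deg-∑ : ∀ {N} (f : Fin N → Bool) → deg f ≡ ∑[ i < N ] bit (f i)
deg-∑ {zero}  f = refl
deg-∑ {suc N} f with f zero
... | true  = cong suc (deg-∑ (f ∘ suc))
... | false = deg-∑ (f ∘ suc)

deg-cong : ∀ {N} {f g : Fin N → Bool} → f ≗ g → deg f ≡ deg g
deg-cong {f = f} {g} f≗g =
  trans (deg-∑ f) (trans (sum-cong-≗ (cong bit ∘ f≗g)) (sym (deg-∑ g)))

deg-remove : ∀ {N} (p : Fin (suc N)) (f : Fin (suc N) → Bool) →
             deg f ≡ bit (f p) + deg (f ∘ punchIn p)
deg-remove p f =
  trans (deg-∑ f) (trans (sum-remove {i = p} (bit ∘ f)) (cong (bit (f p) +_) (sym (deg-∑ (f ∘ punchIn p)))))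

deg-split : ∀ m {n} (f : Fin (m + n) → Bool) → deg f ≡ deg (f ∘ (_↑ˡ n)) + deg (f ∘ (m ↑ʳ_))
deg-split zero    f = refl
deg-split (suc m) f with f zero
... | true  = cong suc (deg-split m (f ∘ suc))
... | false = deg-split m (f ∘ suc)

deg-empty : ∀ {N} {f : Fin N → Bool} → (∀ v → f v ≡ false) → deg f ≡ 0
deg-empty {zero}          _ = refl
deg-empty {suc N} {f} f≡false with f zero | f≡false zero
... | false | refl = deg-empty (f≡false ∘ suc)

deg≡0⇒false : ∀ {N} {f : Fin N → Bool} → deg f ≡ 0 → ∀ v → f v ≡ false
deg≡0⇒false {suc N} {f} d≡0 v with f zero in eq
deg≡0⇒false {suc N} {f} d≡0 zero    | false = eq
deg≡0⇒false {suc N} {f} d≡0 (suc v) | false = deg≡0⇒false d≡0 v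

deg-witness : ∀ {N k} {f : Fin N → Bool} → deg f ≡ suc k → ∃ λ v → f v ≡ true
deg-witness {suc N} {f = f} d≡ with f zero in eq
... | true  = zero , eq
... | false = let v , fv = deg-witness d≡ in suc v , fv

deg-mono : ∀ {N} {f g : Fin N → Bool} → f ⊆ g → deg f ≤ deg g
deg-mono {f = f} {g} f⊆g rewrite deg-∑ f | deg-∑ g = go f g f⊆g
  where
  bit-mono : ∀ {a b} → (a ≡ true → b ≡ true) → bit a ≤ bit b
  bit-mono {false} _ = z≤n
  bit-mono {true}  a⇒b rewrite a⇒b refl = s≤s z≤n
  go : ∀ {N} (f g : Fin N → Bool) → f ⊆ g → ∑[ i < N ] bit (f i) ≤ ∑[ i < N ] bit (g i)
  go {zero}  f g _   = z≤n
  go {suc N} f g f⊆g = +-mono-≤ (bit-mono (f⊆g zero)) (go (f ∘ suc) (g ∘ suc) (f⊆g ∘ suc))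

deg≤size : ∀ {N} (f : Fin N → Bool) → deg f ≤ N
deg≤size f = ∣p∣≤n (tabulate f)

_without_ : ∀ {N} → (Fin N → Bool) → Fin N → Fin N → Bool
(f without p) v = f v ∧ not (does (v ≟ p))

without-≢ : ∀ {N} (f : Fin N → Bool) {p v} → v ≢ p → (f without p) v ≡ f v
without-≢ f {p} {v} v≢p with f v
... | false = refl
... | true  = cong not (dec-false (v ≟ p) v≢p)

without-true : ∀ {N} (f : Fin N → Bool) {p v} → (f without p) v ≡ true → f v ≡ true × v ≢ p
without-true f {p} {v} h with f v | v ≟ p
... | true | no v≢p = refl , v≢p

deg-without : ∀ {N} (f : Fin N → Bool) (p : Fin N) → deg f ≡ bit (f p) + deg (f without p)
deg-without {suc N} f p =
  trans (deg-remove p f) (cong (bit (f p) +_) (sym (trans (deg-remove p (f without p)) removed)))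
  where
  at-p : bit ((f without p) p) ≡ 0
  at-p rewrite dec-true (p ≟ p) refl with f p
  ... | true  = refl
  ... | false = refl
  removed : bit ((f without p) p) + deg ((f without p) ∘ punchIn p) ≡ deg (f ∘ punchIn p)
  removed rewrite at-p = deg-cong (λ i → without-≢ f (punchInᵢ≢i p i))

deg-without-member : ∀ {N k} (f : Fin N → Bool) {v} → f v ≡ true → deg f ≡ suc k → deg (f without v) ≡ k
deg-without-member f {v} fv d≡ =
  suc-injective (trans (cong (λ b → bit b + deg (f without v)) (sym fv)) (trans (sym (deg-without f v)) d≡))

deg-single : ∀ {N} {f : Fin N → Bool} (p : Fin N) → (∀ v → f v ≡ true → v ≡ p) → deg f ≡ bit (f p)
deg-single {f = f} p only-p =
  trans (deg-without f p) (trans (cong (bit (f p) +_) (deg-empty rest)) (+-identityʳ (bit (f p))))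
  where
  rest : ∀ v → (f without p) v ≡ false
  rest v with (f without p) v in eq
  ... | false = refl
  ... | true  = let fv , v≢p = without-true f eq in ⊥-elim (v≢p (only-p v fv))

deg-image : ∀ {N k} {f : Fin N → Bool} (e : Fin k → Fin N) → Injective _≡_ _≡_ e →
            (∀ v → f v ≡ true → ∃ λ j → e j ≡ v) → deg f ≡ deg (f ∘ e)
deg-image {k = zero} {f} e _ onto = deg-empty outside-image
  where
  outside-image : ∀ v → f v ≡ false
  outside-image v with f v in fv
  ... | false = refl
  ... | true with () ← proj₁ (onto v fv)
deg-image {k = suc k} {f} e e-inj onto = begin
  deg f                                              ≡⟨ deg-without f (e zero) ⟩
  bit (f (e zero)) + deg (f without e zero)          ≡⟨ cong (bit (f (e zero)) +_) rest ⟩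
  bit (f (e zero)) + deg (f ∘ e ∘ suc)               ≡⟨ deg-remove zero (f ∘ e) ⟨
  deg (f ∘ e)                                        ∎
  where
  onto′ : ∀ v → (f without e zero) v ≡ true → ∃ λ j → e (suc j) ≡ v
  onto′ v h with without-true f h
  ... | fv , v≢e0 with onto v fv
  ...   | zero  , e0≡v = ⊥-elim (v≢e0 (sym e0≡v))
  ...   | suc j , ej≡v = j , ej≡v
  rest : deg (f without e zero) ≡ deg (f ∘ e ∘ suc)
  rest = trans (deg-image (e ∘ suc) (Fin-suc-injective ∘ e-inj) onto′)
               (deg-cong λ j → without-≢ f {e zero} {e (suc j)} (λ ej≡e0 → 0≢1+n (sym (e-inj ej≡e0))))

record Enumeration {N} (f : Fin N → Bool) (k : ℕ) : Set where
  field
    elem           : Fin k → Fin N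
    elem-∈         : ∀ j → f (elem j) ≡ true
    elem-injective : Injective _≡_ _≡_ elem
    elem-onto      : ∀ v → f v ≡ true → ∃ λ j → elem j ≡ v

  deg-reindex : ∀ {g : Fin N → Bool} → g ⊆ f → deg g ≡ deg (g ∘ elem)
  deg-reindex g⊆f = deg-image elem elem-injective (λ v gv → elem-onto v (g⊆f v gv))

enumerate : ∀ {N} k (f : Fin N → Bool) → deg f ≡ k → Enumeration f k
enumerate zero f d≡0 = record
  { elem = λ () ; elem-∈ = λ () ; elem-injective = λ {}
  ; elem-onto = λ v fv → case trans (sym fv) (deg≡0⇒false d≡0 v) of λ () }
enumerate (suc k) f d≡ = record
  { elem = v ◂ elem ; elem-∈ = ∈ ; elem-injective = injective ; elem-onto = onto }
  where
  w : ∃ λ v → f v ≡ true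
  w = deg-witness d≡
  v : Fin _
  v = proj₁ w
  open Enumeration (enumerate k (f without v) (deg-without-member f (proj₂ w) d≡))
  ∈ : ∀ j → f ((v ◂ elem) j) ≡ true
  ∈ zero    = proj₂ w
  ∈ (suc j) = proj₁ (without-true f (elem-∈ j))
  elem≢v : ∀ j → elem j ≢ v
  elem≢v j = proj₂ (without-true f (elem-∈ j))
  injective : Injective _≡_ _≡_ (v ◂ elem)
  injective {zero}  {zero}  _ = refl
  injective {zero}  {suc j} v≡ = ⊥-elim (elem≢v j (sym v≡))
  injective {suc i} {zero}  ≡v = ⊥-elim (elem≢v i ≡v)
  injective {suc i} {suc j} ≡  = cong suc (elem-injective ≡)
  onto : ∀ u → f u ≡ true → ∃ λ j → (v ◂ elem) j ≡ u
  onto u fu with u ≟ v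
  ... | yes u≡v = zero , sym u≡v
  ... | no u≢v  = let j , ej≡u = elem-onto u (trans (without-≢ f u≢v) fu) in suc j , ej≡u

deg-partition : ∀ {N} (g f : Fin N → Bool) →
                deg f ≡ deg (λ v → g v ∧ f v) + deg (λ v → not (g v) ∧ f v)
deg-partition g f = begin
  deg f                                                       ≡⟨ deg-∑ f ⟩
  ∑[ v < _ ] bit (f v)                                        ≡⟨ sum-cong-≗ split ⟩
  ∑[ v < _ ] (bit (g v ∧ f v) + bit (not (g v) ∧ f v))
    ≡⟨ ∑-distrib-+ (λ v → bit (g v ∧ f v)) (λ v → bit (not (g v) ∧ f v)) ⟩
  ∑[ v < _ ] bit (g v ∧ f v) + ∑[ v < _ ] bit (not (g v) ∧ f v)
    ≡⟨ cong₂ _+_ (deg-∑ (λ v → g v ∧ f v)) (deg-∑ (λ v → not (g v) ∧ f v)) ⟨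
  deg (λ v → g v ∧ f v) + deg (λ v → not (g v) ∧ f v)        ∎
  where
  split : ∀ v → bit (f v) ≡ bit (g v ∧ f v) + bit (not (g v) ∧ f v)
  split v with g v | f v
  ... | true  | true  = refl
  ... | true  | false = refl
  ... | false | true  = refl
  ... | false | false = refl

deg-strict : ∀ {N} {f g : Fin N → Bool} {v} → f ⊆ g → g v ≡ true → f v ≡ false → suc (deg f) ≤ deg g
deg-strict {f = f} {g} {v} f⊆g gv fv rewrite deg-without g v | gv =
  s≤s (deg-mono λ w fw → trans (without-≢ g (λ w≡v → f≢ w≡v fw)) (f⊆g w fw))
  where
  f≢ : ∀ {w} → w ≡ v → f w ≡ true → ⊥
  f≢ refl fw with () ← trans (sym fw) fv

⊆-deg-≤⇒⊇ : ∀ {N} {f g : Fin N → Bool} → f ⊆ g → deg g ≤ deg f → g ⊆ f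
⊆-deg-≤⇒⊇ {f = f} f⊆g dg≤df v gv with f v in fv
... | true  = refl
... | false = ⊥-elim (<-irrefl refl (≤-trans (deg-strict f⊆g gv fv) dg≤df))

deg≡1⇒unique : ∀ {N} {f : Fin N → Bool} → deg f ≡ 1 → ∃ λ v → f v ≡ true × (∀ w → f w ≡ true → w ≡ v)
deg≡1⇒unique {f = f} d≡1 = v , fv , unique
  where
  w : ∃ λ v → f v ≡ true
  w = deg-witness d≡1
  v : Fin _
  v = proj₁ w
  fv : f v ≡ true
  fv = proj₂ w
  rest : deg (f without v) ≡ 0
  rest = deg-without-member f fv d≡1
  unique : ∀ u → f u ≡ true → u ≡ v
  unique u fu with u ≟ v
  ... | yes u≡v = u≡v
  ... | no u≢v with () ← trans (sym (trans (without-≢ f u≢v) fu)) (deg≡0⇒false rest u)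

∑-single : ∀ {N} (h : Fin N → ℕ) (p : Fin N) → (∀ v → v ≢ p → h v ≡ 0) → ∑[ v < N ] h v ≡ h p
∑-single {suc N} h p zero-elsewhere = begin
  ∑[ v < suc N ] h v                            ≡⟨ sum-remove {i = p} h ⟩
  h p + ∑[ i < N ] h (punchIn p i)               ≡⟨ cong (h p +_) (sum-cong-≗ (λ i → zero-elsewhere _ (punchInᵢ≢i p i))) ⟩
  h p + ∑[ i < N ] 0                            ≡⟨ cong (h p +_) (sum-replicate-zero N) ⟩
  h p + 0                                       ≡⟨ +-identityʳ (h p) ⟩
  h p                                           ∎

deg-full : ∀ {N} {f : Fin N → Bool} → deg f ≡ N → ∀ v → f v ≡ true
deg-full {suc N} {f} d≡ v with f zero in f0
deg-full {suc N} {f} d≡ zero    | true  = f0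
deg-full {suc N} {f} d≡ (suc v) | true  = deg-full (suc-injective d≡) v
deg-full {suc N} {f} d≡ v       | false = ⊥-elim (<-irrefl refl (≤-trans (≤-reflexive (sym d≡)) (deg≤size (f ∘ suc))))

unpunch : ∀ {m} (x : Fin (suc m)) → Fin (suc m) → Maybe (Fin m)
unpunch x u with x ≟ u
... | yes _   = nothing
... | no x≢u  = just (punchOut x≢u)

unpunch-at : ∀ {m} (x : Fin (suc m)) → unpunch x x ≡ nothing
unpunch-at x with x ≟ x
... | yes _  = refl
... | no x≢x = ⊥-elim (x≢x refl)

unpunch-punchIn : ∀ {m} (x : Fin (suc m)) a → unpunch x (punchIn x a) ≡ just a
unpunch-punchIn x a with x ≟ punchIn x a
... | yes x≡ = ⊥-elim (punchInᵢ≢i x a (sym x≡))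
... | no  _  = cong just (trans (punchOut-cong x refl) (punchOut-punchIn x))

data PunchView {m} (x : Fin (suc m)) : Fin (suc m) → Set where
  at      : PunchView x x
  punched : ∀ a → PunchView x (punchIn x a)

punchView : ∀ {m} (x u : Fin (suc m)) → PunchView x u
punchView x u with x ≟ u
... | yes refl = at
... | no x≢u   = subst (PunchView x) (punchIn-punchOut x≢u) (punched (punchOut x≢u))

-- Parity

2∣n+n : ∀ n → 2 ∣ n + n
2∣n+n n = divides n (trans (cong (n +_) (sym (+-identityʳ n))) (*-comm 2 n))

2∤1 : ¬ 2 ∣ 1
2∤1 2∣1 with ∣⇒≤ 2∣1
... | s≤s ()

even≤3⇒0or2 : ∀ {k} → 2 ∣ k → k ≤ 3 → k ≡ 0 ⊎ k ≡ 2
even≤3⇒0or2 {0} _   _ = inj₁ refl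
even≤3⇒0or2 {1} 2∣1 _ = ⊥-elim (2∤1 2∣1)
even≤3⇒0or2 {2} _   _ = inj₂ refl
even≤3⇒0or2 {3} 2∣3 _ = ⊥-elim (2∤1 (∣m+n∣m⇒∣n 2∣3 (2∣n+n 1)))
even≤3⇒0or2 {suc (suc (suc (suc k)))} _ (s≤s (s≤s (s≤s ())))

0or2⇒even : ∀ {k} → k ≡ 0 ⊎ k ≡ 2 → 2 ∣ k
0or2⇒even (inj₁ refl) = 2 ∣0
0or2⇒even (inj₂ refl) = 2∣n+n 1

∑-even : ∀ {N} (h : Fin N → ℕ) → (∀ i → 2 ∣ h i) → 2 ∣ ∑[ i < N ] h i
∑-even {zero}  h _    = 2 ∣0
∑-even {suc N} h even = ∣m∣n⇒∣m+n (even zero) (∑-even (h ∘ suc) (even ∘ suc))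

∑∑-symmetric-even : ∀ {N} (h : Fin N → Fin N → ℕ) → (∀ i j → h i j ≡ h j i) → (∀ i → h i i ≡ 0) →
                    2 ∣ ∑[ i < N ] ∑[ j < N ] h i j
∑∑-symmetric-even {zero}  h _   _    = 2 ∣0
∑∑-symmetric-even {suc N} h sym-h diag = subst (2 ∣_) (sym regroup)
  (∣m∣n⇒∣m+n (2∣n+n row) (∑∑-symmetric-even (λ i j → h (suc i) (suc j)) (λ i j → sym-h _ _) (diag ∘ suc)))
  where
  row rest : ℕ
  row  = ∑[ j < N ] h zero (suc j)
  rest = ∑[ i < N ] ∑[ j < N ] h (suc i) (suc j)
  regroup : ∑[ i < suc N ] ∑[ j < suc N ] h i j ≡ (row + row) + rest
  regroup = begin
    (h zero zero + row) + ∑[ i < N ] (h (suc i) zero + ∑[ j < N ] h (suc i) (suc j))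
      ≡⟨ cong₂ (λ d r → (d + row) + r) (diag zero) (∑-distrib-+ (λ i → h (suc i) zero) _) ⟩
    row + (∑[ i < N ] h (suc i) zero + rest)
      ≡⟨ cong (λ c → row + (c + rest)) (sum-cong-≗ (λ i → sym-h (suc i) zero)) ⟩
    row + (row + rest)
      ≡⟨ +-assoc row row rest ⟨
    (row + row) + rest ∎

module _ {N} (R : Fin N → Fin N → Bool) (R-sym : ∀ u v → R u v ≡ R v u) (R-irrefl : ∀ v → R v v ≡ false) where

  handshake : 2 ∣ ∑[ v < N ] deg (R v)
  handshake rewrite sum-cong-≗ (deg-∑ ∘ R) =
    ∑∑-symmetric-even (λ v w → bit (R v w)) (λ v w → cong bit (R-sym v w)) (λ v → cong bit (R-irrefl v))

  even-cut : (out : Fin N → ℕ) → (∀ v → 2 ∣ deg (R v) + out v) → 2 ∣ ∑[ v < N ] out v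
  even-cut out even = ∣m+n∣m⇒∣n total handshake
    where
    total : 2 ∣ ∑[ v < N ] deg (R v) + ∑[ v < N ] out v
    total rewrite sym (∑-distrib-+ (deg ∘ R) out) = ∑-even _ even

-- Walks and reachability

Walk : ∀ {V : Set} → (V → V → Bool) → V → V → Set
Walk E = Star (λ a b → E a b ≡ true)

anyᵇ : ∀ {N} → (Fin N → Bool) → Bool
anyᵇ f = does (any? (λ v → f v ≟ᵇ true))

anyᵇ-intro : ∀ {N} (f : Fin N → Bool) {v} → f v ≡ true → anyᵇ f ≡ true
anyᵇ-intro f {v} fv = dec-true (any? (λ v → f v ≟ᵇ true)) (v , fv)

anyᵇ-witness : ∀ {N} (f : Fin N → Bool) → anyᵇ f ≡ true → ∃ λ v → f v ≡ true
anyᵇ-witness f h with any? (λ v → f v ≟ᵇ true)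
... | yes w = w

anyᵇ-false : ∀ {N} (f : Fin N → Bool) → anyᵇ f ≡ false → ∀ v → f v ≡ false
anyᵇ-false f h v = ¬-not λ fv → case trans (sym h) (anyᵇ-intro f fv) of λ ()

module _ {N} (R : Fin N → Fin N → Bool) where

  Closed : (Fin N → Bool) → Set
  Closed S = ∀ v w → S v ≡ true → R v w ≡ true → S w ≡ true

  record Closure (u : Fin N) : Set where
    field
      member    : Fin N → Bool
      root      : member u ≡ true
      closed    : Closed member
      reachable : ∀ v → member v ≡ true → Walk R u v

  module _ (u : Fin N) where

    stage : ℕ → Fin N → Bool
    stage zero    v = does (v ≟ u)
    stage (suc k) v = stage k v ∨ anyᵇ (λ w → stage k w ∧ R w v)

    stage-root : ∀ k → stage k u ≡ true
    stage-root zero    = dec-true (u ≟ u) refl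
    stage-root (suc k) rewrite stage-root k = refl

    stage-grows : ∀ k → stage k ⊆ stage (suc k)
    stage-grows k v h rewrite h = refl

    stage-reachable : ∀ k v → stage k v ≡ true → Walk R u v
    stage-reachable zero v h with v ≟ u
    ... | yes refl = ε
    stage-reachable (suc k) v h with stage k v in sv
    ... | true = stage-reachable k v sv
    ... | false =
      let w , sw∧Rwv = anyᵇ-witness (λ w → stage k w ∧ R w v) h
      in stage-reachable k w (∧-conicalˡ _ _ sw∧Rwv) ◅◅ (∧-conicalʳ _ _ sw∧Rwv ◅ ε)

    stable-or-grows : ∀ k → Closed (stage k) ⊎ deg (stage k) < deg (stage (suc k))
    stable-or-grows k with deg (stage (suc k)) ≤? deg (stage k)
    ... | no  grows  = inj₂ (≰⇒> grows)
    ... | yes stable = inj₁ λ v w sv Rvw →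
      let step = anyᵇ-intro (λ w′ → stage k w′ ∧ R w′ w) (cong₂ _∧_ sv Rvw)
      in ⊆-deg-≤⇒⊇ (stage-grows k) stable w (trans (cong (stage k w ∨_) step) (∨-zeroʳ (stage k w)))

    closed-or-large : ∀ k → (∃ λ j → Closed (stage j)) ⊎ k ≤ deg (stage k)
    closed-or-large zero = inj₂ z≤n
    closed-or-large (suc k) with closed-or-large k | stable-or-grows k
    ... | inj₁ found | _          = inj₁ found
    ... | inj₂ _     | inj₁ c     = inj₁ (k , c)
    ... | inj₂ large | inj₂ grows = inj₂ (≤-trans (s≤s large) grows)

    closure : Closure u
    closure with closed-or-large (suc N)
    ... | inj₁ (j , c) = record { member = stage j ; root = stage-root j ; closed = c ; reachable = stage-reachable j }
    ... | inj₂ large   = ⊥-elim (<-irrefl refl (≤-trans large (deg≤size (stage (suc N)))))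

-- A cycle minus a vertex

_∖_ : ∀ {N} → (Fin N → Fin N → Bool) → Fin N → Fin N → Fin N → Bool
(E ∖ x) a b = E a b ∧ (not (does (a ≟ x)) ∧ not (does (b ≟ x)))

∖-intro : ∀ {N} (E : Fin N → Fin N → Bool) {x a b} → E a b ≡ true → a ≢ x → b ≢ x → (E ∖ x) a b ≡ true
∖-intro E {x} {a} {b} Eab a≢x b≢x
  rewrite Eab | dec-false (a ≟ x) a≢x | dec-false (b ≟ x) b≢x = refl

∖-edge : ∀ {N} (E : Fin N → Fin N → Bool) {x a b} → (E ∖ x) a b ≡ true → E a b ≡ true × a ≢ x × b ≢ x
∖-edge E {x} {a} {b} h with E a b | a ≟ x | b ≟ x
... | true | no a≢x | no b≢x = refl , a≢x , b≢x

walk-avoids : ∀ {N} (E : Fin N → Fin N → Bool) {x a b} → Walk (E ∖ x) a b → a ≢ x → b ≢ x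
walk-avoids E ε       a≢x = a≢x
walk-avoids E (s ◅ w) _   = walk-avoids E w (proj₂ (proj₂ (∖-edge E s)))

module _ {N} {G : Graph N} (C : Cycle G) where

  E-irrefl : ∀ v → E C v v ≡ false
  E-irrefl v = ¬-not λ Evv → case trans (sym (E⊆G C v v Evv)) (irrefl G v) of λ ()

  edge⇒deg2 : ∀ {a b} → E C a b ≡ true → deg (E C a) ≡ 2
  edge⇒deg2 {a} {b} Eab with two-reg C a
  ... | inj₂ d≡2 = d≡2
  ... | inj₁ d≡0 with () ← trans (sym Eab) (deg≡0⇒false d≡0 b)

deg2⇒punched-neighbour : ∀ {N} {G : Graph (suc N)} (C : Cycle G) {z} → deg (E C z) ≡ 2 →
                         ∃ λ c → E C z (punchIn z c) ≡ true
deg2⇒punched-neighbour C {z} dz with deg-witness {f = E C z} dz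
... | v , zv with punchView z v
...   | at        = case trans (sym zv) (E-irrefl C z) of λ ()
...   | punched c = c , zv

module CycleMinusVertex {N} {G : Graph N} (C : Cycle G) {x u : Fin N} (xu : E C x u ≡ true) where

  private
    ux : E C u x ≡ true
    ux = trans (E-sym C u x) xu

    u≢x : u ≢ x
    u≢x refl with () ← trans (sym xu) (E-irrefl C u)

    other-neighbour : ∃ λ u′ → ∀ w → (E C x without u) w ≡ true → w ≡ u′
    other-neighbour =
      let u′ , _ , only-u′ = deg≡1⇒unique (deg-without-member (E C x) xu (edge⇒deg2 C xu)) in u′ , only-u′

    u′ : Fin N
    u′ = proj₁ other-neighbour

    x-neighbours : ∀ w → E C x w ≡ true → w ≡ u ⊎ w ≡ u′
    x-neighbours w xw with w ≟ u
    ... | yes w≡u = inj₁ w≡u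
    ... | no  w≢u = inj₂ (proj₂ other-neighbour w (trans (without-≢ (E C x) w≢u) xw))

    open Closure (closure (E C ∖ x) u)

    member⇒≢x : ∀ v → member v ≡ true → v ≢ x
    member⇒≢x v h = walk-avoids (E C) (reachable v h) u≢x

    escape⇒x : ∀ {v w} → member v ≡ true → E C v w ≡ true → member w ≡ false → w ≡ x
    escape⇒x {v} {w} mv Evw mw with w ≟ x
    ... | yes w≡x = w≡x
    ... | no  w≢x with () ← trans (sym (closed v w mv (∖-intro (E C) Evw (member⇒≢x v mv) w≢x))) mw

    unpack : ∀ {a b c} → not a ∧ (b ∧ c) ≡ true → a ≡ false × b ≡ true × c ≡ true
    unpack {false} {true} {true} _ = refl , refl , refl

    module _ (u′-outside : member u′ ≡ false) where

      inner : Fin N → Fin N → Bool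
      inner v w = member w ∧ (member v ∧ E C v w)

      leaving : Fin N → ℕ
      leaving v = deg (λ w → not (member w) ∧ (member v ∧ E C v w))

      inner-sym : ∀ v w → inner v w ≡ inner w v
      inner-sym v w rewrite E-sym C v w with member v | member w
      ... | true  | true  = refl
      ... | true  | false = refl
      ... | false | true  = refl
      ... | false | false = refl

      inner-irrefl : ∀ v → inner v v ≡ false
      inner-irrefl v rewrite E-irrefl C v | ∧-zeroʳ (member v) = ∧-zeroʳ (member v)

      inner+leaving-even : ∀ v → 2 ∣ deg (inner v) + leaving v
      inner+leaving-even v rewrite sym (deg-partition member (λ w → member v ∧ E C v w)) with member v
      ... | true  = 0or2⇒even (two-reg C v)
      ... | false = subst (2 ∣_) (sym (deg-empty {N} {λ w → false ∧ E C v w} (λ _ → refl))) (2 ∣0)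

      leaving-elsewhere : ∀ v → v ≢ u → leaving v ≡ 0
      leaving-elsewhere v v≢u = deg-empty {f = λ w → not (member w) ∧ (member v ∧ E C v w)} λ w → ¬-not λ h →
        let mw , mv , Evw = unpack h
            xv = trans (E-sym C x v) (subst (λ z → E C v z ≡ true) (escape⇒x mv Evw mw) Evw)
        in case x-neighbours v xv of λ
             { (inj₁ v≡u)  → v≢u v≡u
             ; (inj₂ refl) → case trans (sym mv) u′-outside of λ () }

      leaving-u : leaving u ≡ 1
      leaving-u = trans (deg-single {f = λ w → not (member w) ∧ (member u ∧ E C u w)} x
                                    (λ w h → let mw , mu , Euw = unpack h in escape⇒x mu Euw mw))
                        (cong bit at-x)
        where
        at-x : not (member x) ∧ (member u ∧ E C u x) ≡ true
        at-x rewrite ¬-not {member x} (λ mx → member⇒≢x x mx refl) | root | ux = refl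

      -- Only the edge ux leaves the closure, but by the handshake argument an even number must.
      odd-cut : ⊥
      odd-cut = 2∤1 (subst (2 ∣_) (trans (∑-single leaving u leaving-elsewhere) leaving-u)
                               (even-cut inner inner-sym inner-irrefl leaving inner+leaving-even))

    other-neighbour-reached : member u′ ≡ true
    other-neighbour-reached = ¬-not odd-cut

    member-or-x : ∀ {a b} → Walk (E C) a b → member a ≡ true ⊎ a ≡ x → member b ≡ true ⊎ b ≡ x
    member-or-x ε h = h
    member-or-x (s ◅ w) (inj₂ refl) with x-neighbours _ s
    ... | inj₁ refl = member-or-x w (inj₁ root)
    ... | inj₂ refl = member-or-x w (inj₁ other-neighbour-reached)
    member-or-x {a} (_◅_ {j = c} s w) (inj₁ ma) with c ≟ x
    ... | yes c≡x = member-or-x w (inj₂ c≡x)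
    ... | no  c≢x = member-or-x w (inj₁ (closed a c ma (∖-intro (E C) s (member⇒≢x a ma) c≢x)))

  reach-avoiding : ∀ v → deg (E C v) ≡ 2 → v ≢ x → Walk (E C ∖ x) u v
  reach-avoiding v dv v≢x with member-or-x (connected C u v (edge⇒deg2 C ux) dv) (inj₁ root)
  ... | inj₁ mv  = reachable v mv
  ... | inj₂ v≡x = ⊥-elim (v≢x v≡x)

through : ∀ {N} {G : Graph N} → Fin N → Cycle G → Bool
through x C = does (deg (E C x) ≟ℕ 2)

tally : ∀ {A : Set} → (A → Bool) → List A → ℕ
tally p L = countTrue (map p L)

tally-∷ : ∀ {A : Set} (p : A → Bool) a L → tally p (a ∷ L) ≡ bit (p a) + tally p L
tally-∷ p a L with p a
... | true  = refl
... | false = refl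

module _ {A : Set} where

  length≡tally : (L : List A) → length L ≡ tally (const true) L
  length≡tally []      = refl
  length≡tally (_ ∷ L) = cong suc (length≡tally L)

  tally-cong : ∀ {p q : A → Bool} → (∀ a → p a ≡ q a) → ∀ L → tally p L ≡ tally q L
  tally-cong p≗q []      = refl
  tally-cong {p} {q} p≗q (a ∷ L) = begin
    tally p (a ∷ L)       ≡⟨ tally-∷ p a L ⟩
    bit (p a) + tally p L ≡⟨ cong₂ _+_ (cong bit (p≗q a)) (tally-cong p≗q L) ⟩
    bit (q a) + tally q L ≡⟨ tally-∷ q a L ⟨
    tally q (a ∷ L)       ∎

  tally-false : ∀ {p : A → Bool} → (∀ a → p a ≡ false) → ∀ L → tally p L ≡ 0
  tally-false p≡false []      = refl
  tally-false {p} p≡false (a ∷ L) rewrite p≡false a = tally-false p≡false L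

  tally-++ : ∀ (p : A → Bool) L M → tally p (L ++ M) ≡ tally p L + tally p M
  tally-++ p []      M = refl
  tally-++ p (a ∷ L) M = begin
    tally p (a ∷ L ++ M)              ≡⟨ tally-∷ p a (L ++ M) ⟩
    bit (p a) + tally p (L ++ M)      ≡⟨ cong (bit (p a) +_) (tally-++ p L M) ⟩
    bit (p a) + (tally p L + tally p M) ≡⟨ +-assoc (bit (p a)) _ _ ⟨
    (bit (p a) + tally p L) + tally p M ≡⟨ cong (_+ tally p M) (tally-∷ p a L) ⟨
    tally p (a ∷ L) + tally p M       ∎

  tally-split : ∀ {p q r : A → Bool} → (∀ a → bit (p a) ≡ bit (q a) + bit (r a)) →
                ∀ L → tally p L ≡ tally q L + tally r L
  tally-split split []      = refl
  tally-split {p} {q} {r} split (a ∷ L) = begin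
    tally p (a ∷ L)                                   ≡⟨ tally-∷ p a L ⟩
    bit (p a) + tally p L                             ≡⟨ cong₂ _+_ (split a) (tally-split split L) ⟩
    (bit (q a) + bit (r a)) + (tally q L + tally r L) ≡⟨ interchange (bit (q a)) (bit (r a)) _ _ ⟩
    (bit (q a) + tally q L) + (bit (r a) + tally r L) ≡⟨ cong₂ _+_ (tally-∷ q a L) (tally-∷ r a L) ⟨
    tally q (a ∷ L) + tally r (a ∷ L)                 ∎

  tally-∑ : ∀ {n} {p : A → Bool} {q : Fin n → A → Bool} → (∀ a → bit (p a) ≡ ∑[ k < n ] bit (q k a)) →
            ∀ L → tally p L ≡ ∑[ k < n ] tally (q k) L
  tally-∑ {n} split []      = sym (sum-replicate-zero n)
  tally-∑ {n} {p} {q} split (a ∷ L) = begin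
    tally p (a ∷ L)                                         ≡⟨ tally-∷ p a L ⟩
    bit (p a) + tally p L                                   ≡⟨ cong₂ _+_ (split a) (tally-∑ {q = q} split L) ⟩
    ∑[ k < n ] bit (q k a) + ∑[ k < n ] tally (q k) L       ≡⟨ ∑-distrib-+ (λ k → bit (q k a)) (λ k → tally (q k) L) ⟨
    ∑[ k < n ] (bit (q k a) + tally (q k) L)                ≡⟨ sum-cong-≗ (λ k → tally-∷ (q k) a L) ⟨
    ∑[ k < n ] tally (q k) (a ∷ L)                          ∎

  tally-map : ∀ {B : Set} (p : B → Bool) (f : A → B) L → tally p (map f L) ≡ tally (p ∘ f) L
  tally-map p f L = cong countTrue (sym (map-∘ L))

  tally-mapMaybe : ∀ {B : Set} (p : B → Bool) (f : A → Maybe B) L →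
                   tally p (mapMaybe f L) ≡ tally (maybe p false ∘ f) L
  tally-mapMaybe p f []      = refl
  tally-mapMaybe p f (a ∷ L) with f a
  ... | nothing = tally-mapMaybe p f L
  ... | just b with p b
  ...   | true  = cong suc (tally-mapMaybe p f L)
  ...   | false = tally-mapMaybe p f L

  length-mapMaybe : ∀ {B : Set} (f : A → Maybe B) L → length (mapMaybe f L) ≡ tally (is-just ∘ f) L
  length-mapMaybe f []      = refl
  length-mapMaybe f (a ∷ L) with f a
  ... | nothing = length-mapMaybe f L
  ... | just _  = cong suc (length-mapMaybe f L)

  tally≡0⇒∧ : ∀ (p g : A → Bool) L → tally p L ≡ 0 → tally (λ c → p c ∧ g c) L ≡ 0
  tally≡0⇒∧ p g []      _ = refl
  tally≡0⇒∧ p g (a ∷ L) h with p a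
  ... | false = tally≡0⇒∧ p g L h

  tally≡1⇒single : ∀ (p : A → Bool) L → tally p L ≡ 1 →
                   ∃ λ a → p a ≡ true × (∀ (g : A → Bool) → tally (λ c → p c ∧ g c) L ≡ bit (g a))
  tally≡1⇒single p (a ∷ L) h with p a in pa
  ... | true  = a , pa , only-a
    where
    only-a : ∀ (g : A → Bool) → countTrue (g a ∷ map (λ c → p c ∧ g c) L) ≡ bit (g a)
    only-a g with g a
    ... | true  = cong suc (tally≡0⇒∧ p g L (suc-injective h))
    ... | false = tally≡0⇒∧ p g L (suc-injective h)
  ... | false = let b , pb , only = tally≡1⇒single p L h
                in b , pb , only

  tally-tabulate : ∀ {n} (p : A → Bool) (f : Fin n → A) → tally p (List.tabulate f) ≡ ∑[ k < n ] bit (p (f k))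
  tally-tabulate {zero}  p f = refl
  tally-tabulate {suc n} p f = trans (tally-∷ p (f zero) _) (cong (bit (p (f zero)) +_) (tally-tabulate p (f ∘ suc)))

  tally-+ : ∀ {p q r s : A → Bool} → (∀ a → bit (p a) + bit (q a) ≡ bit (r a) + bit (s a)) →
            ∀ L → tally p L + tally q L ≡ tally r L + tally s L
  tally-+ _ [] = refl
  tally-+ {p} {q} {r} {s} pointwise (a ∷ L) = begin
    tally p (a ∷ L) + tally q (a ∷ L)                  ≡⟨ cong₂ _+_ (tally-∷ p a L) (tally-∷ q a L) ⟩
    (bit (p a) + tally p L) + (bit (q a) + tally q L)  ≡⟨ interchange (bit (p a)) _ _ _ ⟩
    (bit (p a) + bit (q a)) + (tally p L + tally q L)  ≡⟨ cong₂ _+_ (pointwise a) (tally-+ pointwise L) ⟩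
    (bit (r a) + bit (s a)) + (tally r L + tally s L)  ≡⟨ interchange (bit (r a)) _ _ _ ⟩
    (bit (r a) + tally r L) + (bit (s a) + tally s L)  ≡⟨ cong₂ _+_ (tally-∷ r a L) (tally-∷ s a L) ⟨
    tally r (a ∷ L) + tally s (a ∷ L)                  ∎

-- The cycles of a CDC through a vertex of degree three

module ThreeBits (b : Fin 3 → Bool) where

  two : Bool
  two = does (deg b ≟ℕ 2)

  bit-two : deg b ≡ 0 ⊎ deg b ≡ 2 → ∀ j → bit two ≡ bit (b j) + bit (two ∧ not (b j))
  bit-two deg0or2 j with deg0or2
  ... | inj₁ d≡0 rewrite deg≡0⇒false {f = b} d≡0 j | d≡0 = refl
  ... | inj₂ d≡2 rewrite d≡2 with b j
  ...   | true  = refl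
  ...   | false = refl

  -- Two set bits out of three leave exactly one unset.
  bit-two-∧ : ∀ g → bit (two ∧ g) ≡ ∑[ k < 3 ] bit ((two ∧ not (b k)) ∧ g)
  bit-two-∧ g with two in is-two | g
  ... | false | _     = refl
  ... | true  | false = sym (sum-cong-≗ (λ k → cong bit (∧-zeroʳ (not (b k)))))
  ... | true  | true  = trans (sym misses-one) (deg-∑ (λ k → not (b k) ∧ true))
    where
    d≡2 : deg b ≡ 2
    d≡2 = does⇒ (deg b ≟ℕ 2) is-two
    misses-one : deg (λ k → not (b k) ∧ true) ≡ 1
    misses-one = +-cancelˡ-≡ 2 _ _ (begin
      2 + deg (λ k → not (b k) ∧ true)
        ≡⟨ cong (_+ deg (λ k → not (b k) ∧ true)) (trans (sym d≡2) (deg-cong (λ k → sym (∧-identityʳ (b k))))) ⟩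
      deg (λ k → b k ∧ true) + deg (λ k → not (b k) ∧ true)      ≡⟨ deg-partition b (λ _ → true) ⟨
      deg {3} (λ _ → true)                                       ∎)

2+aⱼ≡∑a⇒aⱼ≡1 : ∀ t (a : Fin 3 → ℕ) → (∀ j → t ≡ 2 + a j) → t ≡ ∑[ j < 3 ] a j → ∀ j → a j ≡ 1
2+aⱼ≡∑a⇒aⱼ≡1 t a edge total j = trans (same j) (half (+-cancelʳ-≡ (a zero) 2 (a zero + a zero) thrice))
  where
  same : ∀ j → a j ≡ a zero
  same j = +-cancelˡ-≡ 2 _ _ (trans (sym (edge j)) (edge zero))
  thrice : 2 + a zero ≡ (a zero + a zero) + a zero
  thrice = begin
    2 + a zero                                           ≡⟨ trans (sym (edge zero)) total ⟩
    a zero + (a (suc zero) + (a (suc (suc zero)) + 0))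
      ≡⟨ cong₂ (λ b c → a zero + (b + c)) (same (suc zero)) (trans (+-identityʳ _) (same (suc (suc zero)))) ⟩
    a zero + (a zero + a zero)                           ≡⟨ +-assoc (a zero) (a zero) (a zero) ⟨
    (a zero + a zero) + a zero                           ∎
  half : ∀ {k} → 2 ≡ k + k → k ≡ 1
  half {1} _ = refl
  half {suc (suc k)} h with () ← trans (suc-injective (suc-injective h)) (+-suc k (suc k))

module Degree3Vertex {N} {G : Graph N} {x : Fin N} (nbrs : Enumeration (adj G x) 3) where
  open Enumeration nbrs renaming (elem to nbr; elem-∈ to nbr-adj)

  x-edges : Cycle G → Fin 3 → Bool
  x-edges C = E C x ∘ nbr

  deg-x-edges : ∀ C → deg (E C x) ≡ deg (x-edges C)
  deg-x-edges C = deg-reindex (E⊆G C x)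

  through≡two : ∀ C → through x C ≡ ThreeBits.two (x-edges C)
  through≡two C = cong (λ d → does (d ≟ℕ 2)) (deg-x-edges C)

  misses : Fin 3 → Cycle G → Bool
  misses k C = through x C ∧ not (E C x (nbr k))

  bit-through : ∀ C j → bit (through x C) ≡ bit (E C x (nbr j)) + bit (misses j C)
  bit-through C j rewrite through≡two C =
    ThreeBits.bit-two (x-edges C) (subst (λ d → d ≡ 0 ⊎ d ≡ 2) (deg-x-edges C) (two-reg C x)) j

  bit-through-∧ : ∀ C g → bit (through x C ∧ g) ≡ ∑[ k < 3 ] bit (misses k C ∧ g)
  bit-through-∧ C g rewrite through≡two C = ThreeBits.bit-two-∧ (x-edges C) g

  module _ (L : List (Cycle G)) (cdc : IsCDC G L) where

    through≡2+misses : ∀ j → tally (through x) L ≡ 2 + tally (misses j) L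
    through≡2+misses j = trans (tally-split (λ C → bit-through C j) L)
                               (cong (_+ tally (misses j) L) (cdc x (nbr j) (nbr-adj j)))

    through≡∑misses : tally (through x) L ≡ ∑[ k < 3 ] tally (misses k) L
    through≡∑misses = tally-∑ {q = misses} (λ C → trans (cong bit (sym (∧-identityʳ (through x C))))
                                           (trans (bit-through-∧ C true) (sum-cong-≗ λ k → cong bit (∧-identityʳ (misses k C))))) L

    misses-once : ∀ k → tally (misses k) L ≡ 1
    misses-once = 2+aⱼ≡∑a⇒aⱼ≡1 _ (λ k → tally (misses k) L) through≡2+misses through≡∑misses

    through-thrice : tally (through x) L ≡ 3
    through-thrice = trans (through≡2+misses zero) (cong (2 +_) (misses-once zero))

    private
      single : ∀ k → ∃ λ C → misses k C ≡ true × (∀ (g : Cycle G → Bool) → tally (λ D → misses k D ∧ g D) L ≡ bit (g C))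
      single k = tally≡1⇒single (misses k) L (misses-once k)

    missing : Fin 3 → Cycle G
    missing k = proj₁ (single k)

    missing-misses : ∀ k → misses k (missing k) ≡ true
    missing-misses k = proj₁ (proj₂ (single k))

    tally-misses-∧ : ∀ k (g : Cycle G → Bool) → tally (λ C → misses k C ∧ g C) L ≡ bit (g (missing k))
    tally-misses-∧ k = proj₂ (proj₂ (single k))

    missing-through : ∀ k → deg (E (missing k) x) ≡ 2
    missing-through k = does⇒ (deg (E (missing k) x) ≟ℕ 2) (∧-conicalˡ _ _ (missing-misses k))

    missing-avoids : ∀ k → E (missing k) x (nbr k) ≡ false
    missing-avoids k = not-injective (∧-conicalʳ _ _ (missing-misses k))

    missing-at-x : ∀ k j → E (missing k) x (nbr j) ≡ not (does (j ≟ k))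
    missing-at-x k j with punchView k j
    ... | at rewrite dec-true (k ≟ k) refl = missing-avoids k
    ... | punched i rewrite dec-false (punchIn k i ≟ k) (punchInᵢ≢i k i) =
      deg-full {f = x-edges (missing k) ∘ punchIn k} others i
      where
      others : deg (x-edges (missing k) ∘ punchIn k) ≡ 2
      others = begin
        deg (x-edges (missing k) ∘ punchIn k)
          ≡⟨ cong (_+ deg (x-edges (missing k) ∘ punchIn k)) (cong bit (missing-avoids k)) ⟨
        bit (x-edges (missing k) k) + deg (x-edges (missing k) ∘ punchIn k)
          ≡⟨ deg-remove k (x-edges (missing k)) ⟨
        deg (x-edges (missing k))
          ≡⟨ trans (sym (deg-x-edges (missing k))) (missing-through k) ⟩
        2 ∎

    tally-decompose : ∀ g → tally g L ≡ tally (λ C → not (through x C) ∧ g C) L + ∑[ k < 3 ] bit (g (missing k))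
    tally-decompose g = trans (tally-split (λ C → bit-split (through x C) (g C)) L)
      (cong (tally (λ C → not (through x C) ∧ g C) L +_)
            (trans (tally-∑ {q = λ k C → misses k C ∧ g C} (λ C → bit-through-∧ C (g C)) L)
                   (sum-cong-≗ (λ k → tally-misses-∧ k g))))
      where
      bit-split : ∀ a b → bit b ≡ bit (not a ∧ b) + bit (a ∧ b)
      bit-split false b = sym (+-identityʳ (bit b))
      bit-split true  b = refl

    length≡avoiding+3 : length L ≡ tally (not ∘ through x) L + 3
    length≡avoiding+3 = trans (length≡tally L)
      (trans (tally-decompose (λ _ → true)) (cong (_+ 3) (tally-cong (λ C → ∧-identityʳ (not (through x C))) L)))

record CycleIn {V : Set} (count : (V → Bool) → ℕ) (K : V → V → Bool) : Set where
  field
    edge           : V → V → Bool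
    edge-sym       : ∀ p q → edge p q ≡ edge q p
    edge⊆K         : ∀ p q → edge p q ≡ true → K p q ≡ true
    two-regular    : ∀ p → count (edge p) ≡ 0 ⊎ count (edge p) ≡ 2
    has-vertex     : ∃ λ p → count (edge p) ≡ 2
    edge-connected : ∀ p q → count (edge p) ≡ 2 → count (edge q) ≡ 2 → Walk edge p q
open CycleIn public

IsCDCIn : ∀ {V : Set} {count : (V → Bool) → ℕ} (K : V → V → Bool) → List (CycleIn count K) → Set
IsCDCIn K L = ∀ p q → K p q ≡ true → tally (λ C → edge C p q) L ≡ 2

module _ {N} {G : Graph N} where

  fromCycle : Cycle G → CycleIn deg (adj G)
  fromCycle C = record
    { edge = E C ; edge-sym = E-sym C ; edge⊆K = E⊆G C ; two-regular = two-reg C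
    ; has-vertex = nonempty C ; edge-connected = connected C }

  toCycle : CycleIn deg (adj G) → Cycle G
  toCycle C = record
    { E = edge C ; E-sym = edge-sym C ; E⊆G = edge⊆K C ; two-reg = two-regular C
    ; nonempty = has-vertex C ; connected = edge-connected C }

  fromCycle-CDC : ∀ L → IsCDC G L → IsCDCIn (adj G) (map fromCycle L)
  fromCycle-CDC L cdc u v uv = trans (tally-map (λ C → edge C u v) fromCycle L) (cdc u v uv)

  toCycle-CDC : ∀ L → IsCDCIn (adj G) L → IsCDC G (map toCycle L)
  toCycle-CDC L cdc u v uv = trans (tally-map (λ C → E C u v) toCycle L) (cdc u v uv)

record Relabelling {V W : Set} (countV : (V → Bool) → ℕ) (countW : (W → Bool) → ℕ) : Set where
  field
    to       : W → V
    from     : V → W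
    to-from  : ∀ v → to (from v) ≡ v
    from-to  : ∀ w → from (to w) ≡ w
    count-to : ∀ h → countW (h ∘ to) ≡ countV h

module _ {V W : Set} {countV : (V → Bool) → ℕ} {countW : (W → Bool) → ℕ}
         (ρ : Relabelling countV countW) {K : V → V → Bool} {K′ : W → W → Bool}
         (K′≡K : ∀ w w′ → K′ w w′ ≡ K (Relabelling.to ρ w) (Relabelling.to ρ w′)) where
  open Relabelling ρ

  relabel : CycleIn countV K → CycleIn countW K′
  relabel C = record
    { edge           = λ w w′ → edge C (to w) (to w′)
    ; edge-sym       = λ w w′ → edge-sym C (to w) (to w′)
    ; edge⊆K         = λ w w′ h → trans (K′≡K w w′) (edge⊆K C (to w) (to w′) h)
    ; two-regular    = λ w → subst (λ k → k ≡ 0 ⊎ k ≡ 2) (sym (count-to (edge C (to w)))) (two-regular C (to w))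
    ; has-vertex     = let p , dp = has-vertex C
                       in from p , trans (count-to _) (subst (λ v → countV (edge C v) ≡ 2) (sym (to-from p)) dp)
    ; edge-connected = λ w w′ dw dw′ →
        subst₂ (Walk _) (from-to w) (from-to w′)
          (gmap from (λ {a} {b} h → subst₂ (λ a′ b′ → edge C a′ b′ ≡ true) (sym (to-from a)) (sym (to-from b)) h)
                (edge-connected C (to w) (to w′) (trans (sym (count-to _)) dw) (trans (sym (count-to _)) dw′)))
    }

  relabel-CDC : ∀ L → IsCDCIn K L → IsCDCIn K′ (map relabel L)
  relabel-CDC L cdc w w′ k = trans (tally-map (λ C → edge C w w′) relabel L) (cdc (to w) (to w′) (trans (sym (K′≡K w w′)) k))

V : ℕ → ℕ → Set
V m n = Fin m ⊎ Fin n

degV : ∀ {m n} → (V m n → Bool) → ℕ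
degV f = deg (f ∘ inj₁) + deg (f ∘ inj₂)

degV≡0⇒false : ∀ {m n} (f : V m n → Bool) → degV f ≡ 0 → ∀ q → f q ≡ false
degV≡0⇒false f d≡0 (inj₁ a) = deg≡0⇒false (m+n≡0⇒m≡0 _ d≡0) a
degV≡0⇒false f d≡0 (inj₂ b) = deg≡0⇒false (m+n≡0⇒n≡0 (deg (f ∘ inj₁)) d≡0) b

split-relabelling : ∀ m n → Relabelling degV (deg {m + n})
split-relabelling m n = record
  { to = splitAt m ; from = join m n ; to-from = splitAt-join m n ; from-to = join-splitAt m n
  ; count-to = λ h → trans (deg-split m (h ∘ splitAt m))
      (cong₂ _+_ (deg-cong (λ i → cong h (splitAt-↑ˡ m i n))) (deg-cong (λ j → cong h (splitAt-↑ʳ m n j)))) }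

join-relabelling : ∀ m n → Relabelling (deg {m + n}) degV
join-relabelling m n = record
  { to = join m n ; from = splitAt m ; to-from = join-splitAt m n ; from-to = splitAt-join m n
  ; count-to = λ h → sym (deg-split m h) }

swap-relabelling : ∀ m n → Relabelling (degV {m} {n}) degV
swap-relabelling m n = record
  { to = swap ; from = swap ; to-from = swap-involutive ; from-to = swap-involutive
  ; count-to = λ h → +-comm (deg (h ∘ inj₂)) (deg (h ∘ inj₁)) }

adj-punched : ∀ {m} (G : Graph (suc m)) {x v} → adj G x v ≡ true → ∃ λ a → v ≡ punchIn x a
adj-punched G {x} {v} xv with punchView x v
... | at        = ⊥-elim (case trans (sym xv) (irrefl G x) of λ ())
... | punched a = a , refl

-- The join G ≡ H on Fin m ⊎ Fin n (G − x on the left and H − y on the right, renumbered by punchIn),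
-- described only through the properties the argument uses, so that exchanging G and H is free.
record Joining (m n : ℕ) : Set where
  field
    G : Graph (suc m)
    H : Graph (suc n)
    x : Fin (suc m)
    y : Fin (suc n)
    J : V m n → V m n → Bool
    J-left           : ∀ a a′ → J (inj₁ a) (inj₁ a′) ≡ adj G (punchIn x a) (punchIn x a′)
    J-right          : ∀ b b′ → J (inj₂ b) (inj₂ b′) ≡ adj H (punchIn y b) (punchIn y b′)
    J-sym            : ∀ p q → J p q ≡ J q p
    cross⇒adjˡ       : ∀ a b → J (inj₁ a) (inj₂ b) ≡ true → adj G x (punchIn x a) ≡ true
    cross⇒adjʳ       : ∀ a b → J (inj₁ a) (inj₂ b) ≡ true → adj H y (punchIn y b) ≡ true
    cross-functional : ∀ a b b′ → J (inj₁ a) (inj₂ b) ≡ true → J (inj₁ a) (inj₂ b′) ≡ true → b ≡ b′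
    cross-injective  : ∀ a a′ b → J (inj₁ a) (inj₂ b) ≡ true → J (inj₁ a′) (inj₂ b) ≡ true → a ≡ a′
    cross-totalˡ     : ∀ a → adj G x (punchIn x a) ≡ true → ∃ λ b → J (inj₁ a) (inj₂ b) ≡ true
    cross-totalʳ     : ∀ b → adj H y (punchIn y b) ≡ true → ∃ λ a → J (inj₁ a) (inj₂ b) ≡ true
    deg-x            : deg (adj G x) ≡ 3
    deg-y            : deg (adj H y) ≡ 3

  JCycle : Set
  JCycle = CycleIn degV J

swapJoining : ∀ {m n} → Joining m n → Joining n m
swapJoining S = record
  { G = H ; H = G ; x = y ; y = x
  ; J                = λ p q → J (swap p) (swap q)
  ; J-left           = J-right
  ; J-right          = J-left
  ; J-sym            = λ p q → J-sym (swap p) (swap q)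
  ; cross⇒adjˡ       = λ b a h → cross⇒adjʳ a b (flip h)
  ; cross⇒adjʳ       = λ b a h → cross⇒adjˡ a b (flip h)
  ; cross-functional = λ b a a′ h h′ → cross-injective a a′ b (flip h) (flip h′)
  ; cross-injective  = λ b b′ a h h′ → cross-functional a b b′ (flip h) (flip h′)
  ; cross-totalˡ     = λ b h → let a , k = cross-totalʳ b h in a , flip′ k
  ; cross-totalʳ     = λ a h → let b , k = cross-totalˡ a h in b , flip′ k
  ; deg-x            = deg-y
  ; deg-y            = deg-x
  }
  where
  open Joining S
  flip : ∀ {a b} → J (inj₂ b) (inj₁ a) ≡ true → J (inj₁ a) (inj₂ b) ≡ true
  flip {a} {b} h = trans (J-sym (inj₁ a) (inj₂ b)) h
  flip′ : ∀ {a b} → J (inj₁ a) (inj₂ b) ≡ true → J (inj₂ b) (inj₁ a) ≡ true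
  flip′ {a} {b} h = trans (J-sym (inj₂ b) (inj₁ a)) h

module _ {m n} (S : Joining m n) where
  open Joining S

  swapCycle : JCycle → Joining.JCycle (swapJoining S)
  swapCycle = relabel (swap-relabelling m n) (λ _ _ → refl)

  swapCycle-degV : ∀ C p → degV (edge (swapCycle C) p) ≡ degV (edge C (swap p))
  swapCycle-degV C p = +-comm (deg (edge C (swap p) ∘ inj₂)) _

  swapCycle-CDC : ∀ L → IsCDCIn J L → IsCDCIn (Joining.J (swapJoining S)) (map swapCycle L)
  swapCycle-CDC = relabel-CDC (swap-relabelling m n) (λ _ _ → refl)

  unswapCycle : Joining.JCycle (swapJoining S) → JCycle
  unswapCycle = relabel (swap-relabelling n m) (λ p q → sym (cong₂ J (swap-involutive p) (swap-involutive q)))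

-- Contracting one side of a cycle of the join

module Projection {m n} (S : Joining m n) where
  open Joining S

  J-irrefl : ∀ p → J p p ≡ false
  J-irrefl (inj₁ a) = trans (J-left a a) (irrefl G _)
  J-irrefl (inj₂ b) = trans (J-right b b) (irrefl H _)

  module _ (C : JCycle) where

    edge-irrefl : ∀ p → edge C p p ≡ false
    edge-irrefl p = ¬-not λ h → case trans (sym (edge⊆K C p p h)) (J-irrefl p) of λ ()

    edge⇒degV2 : ∀ {p q} → edge C p q ≡ true → degV (edge C p) ≡ 2
    edge⇒degV2 {p} {q} h with two-regular C p
    ... | inj₂ d≡2 = d≡2
    ... | inj₁ d≡0 = case trans (sym h) (degV≡0⇒false (edge C p) d≡0 q) of λ ()

    crossing : Fin m → Fin n → Bool
    crossing a b = edge C (inj₁ a) (inj₂ b)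

    crosses-at : Fin m → Bool
    crosses-at a = anyᵇ (crossing a)

    crosses-at≡crossing : ∀ {a b} → J (inj₁ a) (inj₂ b) ≡ true → crosses-at a ≡ crossing a b
    crosses-at≡crossing {a} {b} k with crosses-at a in h
    ... | false = sym (anyᵇ-false (crossing a) h b)
    ... | true  = let b′ , c′ = anyᵇ-witness (crossing a) h
                  in sym (subst (λ z → crossing a z ≡ true) (cross-functional a b′ b (edge⊆K C _ _ c′) k) c′)

    deg-crossing : ∀ a → deg (crossing a) ≡ bit (crosses-at a)
    deg-crossing a with crosses-at a in h
    ... | false = deg-empty (anyᵇ-false (crossing a) h)
    ... | true  = let b , c = anyᵇ-witness (crossing a) h in
      trans (deg-single b (λ b′ c′ → cross-functional a b′ b (edge⊆K C _ _ c′) (edge⊆K C _ _ c))) (cong bit c)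

    -- nothing stands for x, into which the right side of C is contracted
    projEdge′ : Maybe (Fin m) → Maybe (Fin m) → Bool
    projEdge′ nothing  nothing   = false
    projEdge′ nothing  (just a)  = crosses-at a
    projEdge′ (just a) nothing   = crosses-at a
    projEdge′ (just a) (just a′) = edge C (inj₁ a) (inj₁ a′)

    projEdge : Fin (suc m) → Fin (suc m) → Bool
    projEdge u v = projEdge′ (unpunch x u) (unpunch x v)

    proj-xx : projEdge x x ≡ false
    proj-xx rewrite unpunch-at x = refl

    proj-xa : ∀ a → projEdge x (punchIn x a) ≡ crosses-at a
    proj-xa a rewrite unpunch-at x | unpunch-punchIn x a = refl

    proj-ax : ∀ a → projEdge (punchIn x a) x ≡ crosses-at a
    proj-ax a rewrite unpunch-at x | unpunch-punchIn x a = refl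

    proj-aa : ∀ a a′ → projEdge (punchIn x a) (punchIn x a′) ≡ edge C (inj₁ a) (inj₁ a′)
    proj-aa a a′ rewrite unpunch-punchIn x a | unpunch-punchIn x a′ = refl

    proj-sym : ∀ u v → projEdge u v ≡ projEdge v u
    proj-sym u v with unpunch x u | unpunch x v
    ... | nothing | nothing = refl
    ... | nothing | just _  = refl
    ... | just _  | nothing = refl
    ... | just a  | just a′ = edge-sym C (inj₁ a) (inj₁ a′)

    crosses-at⇒adj : ∀ a → crosses-at a ≡ true → adj G x (punchIn x a) ≡ true
    crosses-at⇒adj a h = let b , c = anyᵇ-witness (crossing a) h in cross⇒adjˡ a b (edge⊆K C _ _ c)

    proj⊆G : ∀ u v → projEdge u v ≡ true → adj G u v ≡ true
    proj⊆G u v h with punchView x u | punchView x v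
    ... | at        | at         = case trans (sym h) proj-xx of λ ()
    ... | at        | punched a  = crosses-at⇒adj a (trans (sym (proj-xa a)) h)
    ... | punched a | at         = trans (adj-sym G _ _) (crosses-at⇒adj a (trans (sym (proj-ax a)) h))
    ... | punched a | punched a′ = trans (sym (J-left a a′)) (edge⊆K C _ _ (trans (sym (proj-aa a a′)) h))

    deg-proj-punched : ∀ a → deg (projEdge (punchIn x a)) ≡ degV (edge C (inj₁ a))
    deg-proj-punched a = begin
      deg (projEdge (punchIn x a))
        ≡⟨ deg-remove x (projEdge (punchIn x a)) ⟩
      bit (projEdge (punchIn x a) x) + deg (projEdge (punchIn x a) ∘ punchIn x)
        ≡⟨ cong₂ _+_ (trans (cong bit (proj-ax a)) (sym (deg-crossing a))) (deg-cong (proj-aa a)) ⟩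
      deg (crossing a) + deg (edge C (inj₁ a) ∘ inj₁)
        ≡⟨ +-comm (deg (crossing a)) _ ⟩
      degV (edge C (inj₁ a)) ∎

    deg-proj-x : deg (projEdge x) ≡ ∑[ a < m ] deg (crossing a)
    deg-proj-x = begin
      deg (projEdge x)                                   ≡⟨ deg-remove x (projEdge x) ⟩
      bit (projEdge x x) + deg (projEdge x ∘ punchIn x)  ≡⟨ cong₂ _+_ (cong bit proj-xx) (deg-cong proj-xa) ⟩
      deg crosses-at                                     ≡⟨ deg-∑ crosses-at ⟩
      ∑[ a < m ] bit (crosses-at a)                      ≡⟨ sum-cong-≗ (sym ∘ deg-crossing) ⟩
      ∑[ a < m ] deg (crossing a)                        ∎

    -- The degree of x in the projection is the number of crossing edges of C, which is even by
    -- the handshake argument on the G-side of C, and at most deg x = 3.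
    proj-two-regular-x : deg (projEdge x) ≡ 0 ⊎ deg (projEdge x) ≡ 2
    proj-two-regular-x = even≤3⇒0or2
      (subst (2 ∣_) (sym deg-proj-x)
        (even-cut (λ a a′ → edge C (inj₁ a) (inj₁ a′)) (λ a a′ → edge-sym C _ _) (λ a → edge-irrefl (inj₁ a))
                  (deg ∘ crossing) (λ a → 0or2⇒even (two-regular C (inj₁ a)))))
      (≤-trans (deg-mono (proj⊆G x)) (≤-reflexive deg-x))

    proj-two-regular : ∀ u → deg (projEdge u) ≡ 0 ⊎ deg (projEdge u) ≡ 2
    proj-two-regular u with punchView x u
    ... | at        = proj-two-regular-x
    ... | punched a rewrite deg-proj-punched a = two-regular C (inj₁ a)

    contract : V m n → Fin (suc m)
    contract (inj₁ a) = punchIn x a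
    contract (inj₂ _) = x

    contract-step : ∀ {p q} → edge C p q ≡ true → Walk projEdge (contract p) (contract q)
    contract-step {inj₁ a} {inj₁ a′} h = trans (proj-aa a a′) h ◅ ε
    contract-step {inj₁ a} {inj₂ b}  h = trans (proj-ax a) (anyᵇ-intro (crossing a) h) ◅ ε
    contract-step {inj₂ b} {inj₁ a}  h =
      trans (proj-xa a) (anyᵇ-intro (crossing a) (trans (edge-sym C (inj₁ a) (inj₂ b)) h)) ◅ ε
    contract-step {inj₂ _} {inj₂ _}  h = ε

    anchor : ∀ u → deg (projEdge u) ≡ 2 → ∃ λ p → degV (edge C p) ≡ 2 × Walk projEdge u (contract p)
    anchor u du with punchView x u
    ... | punched a = inj₁ a , trans (sym (deg-proj-punched a)) du , ε
    ... | at with deg-witness {f = projEdge x} du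
    ...   | v , xv with punchView x v
    ...     | at        = case trans (sym xv) proj-xx of λ ()
    ...     | punched a =
      let b , c = anyᵇ-witness (crossing a) (trans (sym (proj-xa a)) xv)
      in inj₁ a , edge⇒degV2 c , xv ◅ ε

    proj-connected : ∀ u v → deg (projEdge u) ≡ 2 → deg (projEdge v) ≡ 2 → Walk projEdge u v
    proj-connected u v du dv =
      let p , dp , u→p = anchor u du
          q , dq , v→q = anchor v dv
      in u→p ◅◅ concat (gmap contract contract-step (edge-connected C p q dp dq))
             ◅◅ reverse (λ {a} {b} h → trans (proj-sym b a) h) v→q

    Touches : Set
    Touches = ∃ λ a → degV (edge C (inj₁ a)) ≡ 2

    touches? : Dec Touches
    touches? = any? (λ a → degV (edge C (inj₁ a)) ≟ℕ 2)

    project : Touches → Cycle G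
    project (a , da) = record
      { E = projEdge ; E-sym = proj-sym ; E⊆G = proj⊆G ; two-reg = proj-two-regular
      ; nonempty = punchIn x a , trans (deg-proj-punched a) da ; connected = proj-connected }

    project? : Maybe (Cycle G)
    project? with touches?
    ... | yes t = just (project t)
    ... | no  _ = nothing

    crosses : Bool
    crosses = does (deg (projEdge x) ≟ℕ 2)

    untouched : ¬ Touches → ∀ u v → projEdge u v ≡ false
    untouched no-touch u v = empty (unpunch x u) (unpunch x v)
      where
      isolated : ∀ a q → edge C (inj₁ a) q ≡ false
      isolated a q with two-regular C (inj₁ a)
      ... | inj₁ d≡0 = degV≡0⇒false (edge C (inj₁ a)) d≡0 q
      ... | inj₂ d≡2 = ⊥-elim (no-touch (a , d≡2))
      no-crossing : ∀ a → crosses-at a ≡ false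
      no-crossing a = ¬-not λ h →
        let b , c = anyᵇ-witness (crossing a) h in case trans (sym c) (isolated a (inj₂ b)) of λ ()
      empty : ∀ a a′ → projEdge′ a a′ ≡ false
      empty nothing  nothing   = refl
      empty nothing  (just a)  = no-crossing a
      empty (just a) nothing   = no-crossing a
      empty (just a) (just a′) = isolated a (inj₁ a′)

    project?-edge : ∀ u v → maybe (λ D → E D u v) false project? ≡ projEdge u v
    project?-edge u v with touches?
    ... | yes _        = refl
    ... | no  no-touch = sym (untouched no-touch u v)

    is-just-project? : is-just project? ≡ does touches?
    is-just-project? with touches?
    ... | yes _ = refl
    ... | no  _ = refl

    project?-through : maybe (through x) false project? ≡ crosses
    project?-through with touches?
    ... | yes _        = refl
    ... | no  no-touch rewrite deg-empty (untouched no-touch x) = refl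

    crossing⇒crosses : ∀ {a b} → crossing a b ≡ true → crosses ≡ true
    crossing⇒crosses {a} {b} c with proj-two-regular-x
    ... | inj₂ d≡2 rewrite d≡2 = refl
    ... | inj₁ d≡0 =
      case trans (sym (trans (proj-xa a) (anyᵇ-intro (crossing a) c))) (deg≡0⇒false {f = projEdge x} d≡0 (punchIn x a))
      of λ ()

    crosses⇒crossing : crosses ≡ true → ∃ λ a → ∃ λ b → crossing a b ≡ true
    crosses⇒crossing h with deg-witness {f = projEdge x} (does⇒ (deg (projEdge x) ≟ℕ 2) h)
    ... | v , xv with punchView x v
    ...   | at        = case trans (sym xv) proj-xx of λ ()
    ...   | punched a = a , anyᵇ-witness (crossing a) (trans (sym (proj-xa a)) xv)

    walk⇒crosses : ∀ {p q} → Walk (edge C) p q → ∀ {a b} → p ≡ inj₁ a → q ≡ inj₂ b → crosses ≡ true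
    walk⇒crosses ε refl ()
    walk⇒crosses (_◅_ {j = inj₁ a′} s w) refl q≡ = walk⇒crosses w refl q≡
    walk⇒crosses (_◅_ {j = inj₂ b′} s w) refl _  = crossing⇒crosses s

    touches-both⇒crosses : ∀ {a b} → degV (edge C (inj₁ a)) ≡ 2 → degV (edge C (inj₂ b)) ≡ 2 → crosses ≡ true
    touches-both⇒crosses da db = walk⇒crosses (edge-connected C _ _ da db) refl refl

    crosses⇒touches-both : crosses ≡ true → Touches × ∃ λ b → degV (edge C (inj₂ b)) ≡ 2
    crosses⇒touches-both cr =
      let a , b , c = crosses⇒crossing cr
      in (a , edge⇒degV2 c) , (b , edge⇒degV2 (trans (edge-sym C (inj₂ b) (inj₁ a)) c))

  project-CDC : ∀ L → IsCDCIn J L → IsCDC G (mapMaybe project? L)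
  project-CDC L cdc u v uv = begin
    tally (λ D → E D u v) (mapMaybe project? L)              ≡⟨ tally-mapMaybe (λ D → E D u v) project? L ⟩
    tally (λ C → maybe (λ D → E D u v) false (project? C)) L ≡⟨ tally-cong (λ C → project?-edge C u v) L ⟩
    tally (λ C → projEdge C u v) L                           ≡⟨ tally-proj u v uv ⟩
    2                                                        ∎
    where
    tally-proj : ∀ u v → adj G u v ≡ true → tally (λ C → projEdge C u v) L ≡ 2
    tally-proj u v uv with punchView x u | punchView x v
    ... | at        | at         = case trans (sym uv) (irrefl G x) of λ ()
    ... | at        | punched a  = let b , k = cross-totalˡ a uv in
      trans (tally-cong (λ C → trans (proj-xa C a) (crosses-at≡crossing C k)) L) (cdc (inj₁ a) (inj₂ b) k)
    ... | punched a | at         = let b , k = cross-totalˡ a (trans (adj-sym G x _) uv) in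
      trans (tally-cong (λ C → trans (proj-ax C a) (crosses-at≡crossing C k)) L) (cdc (inj₁ a) (inj₂ b) k)
    ... | punched a | punched a′ =
      trans (tally-cong (λ C → proj-aa C a a′) L) (cdc (inj₁ a) (inj₁ a′) (trans (J-left a a′) uv))

-- Lifting and gluing cycles of G and H

module LeftSide {m n} (S : Joining m n) (A : Cycle (Joining.G S)) (R : V m n → V m n → Bool)
  (R-left  : ∀ a a′ → R (inj₁ a) (inj₁ a′) ≡ E A (punchIn (Joining.x S) a) (punchIn (Joining.x S) a′))
  (R-cross : ∀ a → deg (λ b → R (inj₁ a) (inj₂ b)) ≡ bit (E A (punchIn (Joining.x S) a) (Joining.x S))) where
  open Joining S

  degV-left : ∀ a → degV (R (inj₁ a)) ≡ deg (E A (punchIn x a))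
  degV-left a = begin
    deg (R (inj₁ a) ∘ inj₁) + deg (R (inj₁ a) ∘ inj₂)                  ≡⟨ cong₂ _+_ (deg-cong (R-left a)) (R-cross a) ⟩
    deg (E A (punchIn x a) ∘ punchIn x) + bit (E A (punchIn x a) x)    ≡⟨ +-comm _ (bit (E A (punchIn x a) x)) ⟩
    bit (E A (punchIn x a) x) + deg (E A (punchIn x a) ∘ punchIn x)    ≡⟨ deg-remove x (E A (punchIn x a)) ⟨
    deg (E A (punchIn x a))                                            ∎

  lift-walk : ∀ {c d} → Walk (E A ∖ x) c d →
              ∀ {a a′} → c ≡ punchIn x a → d ≡ punchIn x a′ → Walk R (inj₁ a) (inj₁ a′)
  lift-walk ε {a} {a′} refl d≡ with punchIn-injective x a a′ d≡
  ... | refl = ε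
  lift-walk (_◅_ {j = e} s w) {a} refl d≡ with punchView x e
  ... | at        = ⊥-elim (proj₂ (proj₂ (∖-edge (E A) s)) refl)
  ... | punched a″ = trans (R-left a a″) (proj₁ (∖-edge (E A) s)) ◅ lift-walk w refl d≡

module Lift {m n} (S : Joining m n) (A : Cycle (Joining.G S)) (avoids : deg (E A (Joining.x S)) ≡ 0) where
  open Joining S

  private
    x-isolated : ∀ v → E A x v ≡ false
    x-isolated = deg≡0⇒false avoids

    x-isolated′ : ∀ v → E A v x ≡ false
    x-isolated′ v = trans (E-sym A v x) (x-isolated v)

  liftEdge : V m n → V m n → Bool
  liftEdge (inj₁ a) (inj₁ a′) = E A (punchIn x a) (punchIn x a′)
  liftEdge (inj₁ _) (inj₂ _)  = false
  liftEdge (inj₂ _) _         = false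

  open LeftSide S A liftEdge (λ _ _ → refl)
    (λ a → trans (deg-empty {n} (λ _ → refl)) (cong bit (sym (x-isolated′ (punchIn x a)))))

  private
    liftEdge-sym : ∀ p q → liftEdge p q ≡ liftEdge q p
    liftEdge-sym (inj₁ a) (inj₁ a′) = E-sym A _ _
    liftEdge-sym (inj₁ _) (inj₂ _)  = refl
    liftEdge-sym (inj₂ _) (inj₁ _)  = refl
    liftEdge-sym (inj₂ _) (inj₂ _)  = refl

    liftEdge⊆J : ∀ p q → liftEdge p q ≡ true → J p q ≡ true
    liftEdge⊆J (inj₁ a) (inj₁ a′) h = trans (J-left a a′) (E⊆G A _ _ h)

    right-isolated : ∀ b → degV (liftEdge (inj₂ b)) ≡ 0
    right-isolated b = cong₂ _+_ (deg-empty {m} (λ _ → refl)) (deg-empty {n} (λ _ → refl))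

    two-regular′ : ∀ p → degV (liftEdge p) ≡ 0 ⊎ degV (liftEdge p) ≡ 2
    two-regular′ (inj₁ a) rewrite degV-left a = two-reg A (punchIn x a)
    two-regular′ (inj₂ b) = inj₁ (right-isolated b)

    has-vertex′ : ∃ λ p → degV (liftEdge p) ≡ 2
    has-vertex′ with nonempty A
    ... | v , dv with punchView x v
    ...   | at        = case trans (sym avoids) dv of λ ()
    ...   | punched a = inj₁ a , trans (degV-left a) dv

    avoiding : ∀ {c d} → E A c d ≡ true → (E A ∖ x) c d ≡ true
    avoiding {c} {d} h = ∖-intro (E A) h (λ { refl → case trans (sym h) (x-isolated d) of λ () })
                                         (λ { refl → case trans (sym h) (x-isolated′ c) of λ () })

    connected′ : ∀ p q → degV (liftEdge p) ≡ 2 → degV (liftEdge q) ≡ 2 → Walk liftEdge p q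
    connected′ (inj₂ b) _ dp _ = case trans (sym (right-isolated b)) dp of λ ()
    connected′ (inj₁ _) (inj₂ b) _ dq = case trans (sym (right-isolated b)) dq of λ ()
    connected′ (inj₁ a) (inj₁ a′) dp dq =
      lift-walk (RTC.map avoiding (connected A _ _ (trans (sym (degV-left a)) dp) (trans (sym (degV-left a′)) dq))) refl refl

  lift : JCycle
  lift = record
    { edge = liftEdge ; edge-sym = liftEdge-sym ; edge⊆K = liftEdge⊆J ; two-regular = two-regular′
    ; has-vertex = has-vertex′ ; edge-connected = connected′ }

module _ {m n} (S : Joining m n) where
  open Joining S

  glueEdge : Cycle G → Cycle H → V m n → V m n → Bool
  glueEdge A B (inj₁ a) (inj₁ a′) = E A (punchIn x a) (punchIn x a′)
  glueEdge A B (inj₂ b) (inj₂ b′) = E B (punchIn y b) (punchIn y b′)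
  glueEdge A B (inj₁ a) (inj₂ b)  = J (inj₁ a) (inj₂ b) ∧ (E A x (punchIn x a) ∧ E B y (punchIn y b))
  glueEdge A B (inj₂ b) (inj₁ a)  = J (inj₂ b) (inj₁ a) ∧ (E B y (punchIn y b) ∧ E A x (punchIn x a))

glueEdge-swap : ∀ {m n} (S : Joining m n) A B p q →
                glueEdge (swapJoining S) B A p q ≡ glueEdge S A B (swap p) (swap q)
glueEdge-swap S A B (inj₁ _) (inj₁ _) = refl
glueEdge-swap S A B (inj₁ _) (inj₂ _) = refl
glueEdge-swap S A B (inj₂ _) (inj₁ _) = refl
glueEdge-swap S A B (inj₂ _) (inj₂ _) = refl

Matching : ∀ {m n} (S : Joining m n) → Cycle (Joining.G S) → Cycle (Joining.H S) → Set
Matching S A B = ∀ a b → J (inj₁ a) (inj₂ b) ≡ true → E A x (punchIn x a) ≡ E B y (punchIn y b)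
  where open Joining S

swapMatching : ∀ {m n} (S : Joining m n) {A B} → Matching S A B → Matching (swapJoining S) B A
swapMatching S match b a h = sym (match a b (trans (Joining.J-sym S (inj₁ a) (inj₂ b)) h))

module HalfGlue {m n} (S : Joining m n) (A : Cycle (Joining.G S)) (B : Cycle (Joining.H S))
                (match : Matching S A B) where
  open Joining S

  deg-cross : ∀ a → deg (λ b → glueEdge S A B (inj₁ a) (inj₂ b)) ≡ bit (E A (punchIn x a) x)
  deg-cross a with E A x (punchIn x a) in xa
  ... | false = trans (deg-empty (λ b → ∧-zeroʳ (J (inj₁ a) (inj₂ b)))) (cong bit (sym (trans (E-sym A _ x) xa)))
  ... | true  =
    let b₀ , k = cross-totalˡ a (E⊆G A x _ xa)
        at-b₀ : J (inj₁ a) (inj₂ b₀) ∧ E B y (punchIn y b₀) ≡ true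
        at-b₀ = cong₂ _∧_ k (trans (sym (match a b₀ k)) xa)
    in trans (deg-single b₀ (λ b h → cross-functional a b b₀ (∧-conicalˡ _ _ h) k))
             (trans (cong bit at-b₀) (cong bit (sym (trans (E-sym A _ x) xa))))

  open LeftSide S A (glueEdge S A B) (λ _ _ → refl) deg-cross public

module Glue {m n} (S : Joining m n) (A : Cycle (Joining.G S)) (B : Cycle (Joining.H S))
  (A-through : deg (E A (Joining.x S)) ≡ 2) (B-through : deg (E B (Joining.y S)) ≡ 2)
  (match : Matching S A B) where
  open Joining S

  private
    module L = HalfGlue S A B match
    module R = HalfGlue (swapJoining S) B A (swapMatching S {A} {B} match)

    edge′ : V m n → V m n → Bool
    edge′ = glueEdge S A B

    from-right : ∀ {p q} → Walk (glueEdge (swapJoining S) B A) p q → Walk edge′ (swap p) (swap q)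
    from-right = gmap swap (λ {p} {q} h → trans (sym (glueEdge-swap S A B p q)) h)

    degV-right : ∀ b → degV (edge′ (inj₂ b)) ≡ deg (E B (punchIn y b))
    degV-right b = trans (+-comm (deg (edge′ (inj₂ b) ∘ inj₁)) _) (R.degV-left b)

    sym′ : ∀ p q → edge′ p q ≡ edge′ q p
    sym′ (inj₁ a) (inj₁ a′) = E-sym A _ _
    sym′ (inj₂ b) (inj₂ b′) = E-sym B _ _
    sym′ (inj₁ a) (inj₂ b)  = cong₂ _∧_ (J-sym (inj₁ a) (inj₂ b)) (∧-comm (E A x (punchIn x a)) _)
    sym′ (inj₂ b) (inj₁ a)  = cong₂ _∧_ (J-sym (inj₂ b) (inj₁ a)) (∧-comm (E B y (punchIn y b)) _)

    ⊆J : ∀ p q → edge′ p q ≡ true → J p q ≡ true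
    ⊆J (inj₁ a) (inj₁ a′) h = trans (J-left a a′) (E⊆G A _ _ h)
    ⊆J (inj₂ b) (inj₂ b′) h = trans (J-right b b′) (E⊆G B _ _ h)
    ⊆J (inj₁ a) (inj₂ b)  h = ∧-conicalˡ _ _ h
    ⊆J (inj₂ b) (inj₁ a)  h = ∧-conicalˡ _ _ h

    two-regular′ : ∀ p → degV (edge′ p) ≡ 0 ⊎ degV (edge′ p) ≡ 2
    two-regular′ (inj₁ a) rewrite L.degV-left a = two-reg A (punchIn x a)
    two-regular′ (inj₂ b) rewrite degV-right b  = two-reg B (punchIn y b)

    a₀ : Fin m
    a₀ = proj₁ (deg2⇒punched-neighbour A A-through)
    xa₀ : E A x (punchIn x a₀) ≡ true
    xa₀ = proj₂ (deg2⇒punched-neighbour A A-through)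
    b₀ : Fin n
    b₀ = proj₁ (deg2⇒punched-neighbour B B-through)
    yb₀ : E B y (punchIn y b₀) ≡ true
    yb₀ = proj₂ (deg2⇒punched-neighbour B B-through)

    reach-left : ∀ a → deg (E A (punchIn x a)) ≡ 2 → Walk edge′ (inj₁ a₀) (inj₁ a)
    reach-left a da = L.lift-walk (CycleMinusVertex.reach-avoiding A xa₀ (punchIn x a) da (punchInᵢ≢i x a)) refl refl

    reach-right : ∀ b → deg (E B (punchIn y b)) ≡ 2 → Walk edge′ (inj₂ b₀) (inj₂ b)
    reach-right b db =
      from-right (R.lift-walk (CycleMinusVertex.reach-avoiding B yb₀ (punchIn y b) db (punchInᵢ≢i y b)) refl refl)

    -- By the matching, the partner of b₀ is a neighbour of x in A.
    bridge : ∃ λ a₁ → deg (E A (punchIn x a₁)) ≡ 2 × edge′ (inj₁ a₁) (inj₂ b₀) ≡ true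
    bridge =
      let a₁ , k = cross-totalʳ b₀ (E⊆G B y _ yb₀)
          xa₁ = trans (match a₁ b₀ k) yb₀
      in a₁ , edge⇒deg2 A (trans (E-sym A _ x) xa₁) , cong₂ _∧_ k (cong₂ _∧_ xa₁ yb₀)

    reach : ∀ p → degV (edge′ p) ≡ 2 → Walk edge′ (inj₁ a₀) p
    reach (inj₁ a) dp = reach-left a (trans (sym (L.degV-left a)) dp)
    reach (inj₂ b) dp =
      let a₁ , da₁ , cross = bridge
      in reach-left a₁ da₁ ◅◅ (cross ◅ reach-right b (trans (sym (degV-right b)) dp))

    connected′ : ∀ p q → degV (edge′ p) ≡ 2 → degV (edge′ q) ≡ 2 → Walk edge′ p q
    connected′ p q dp dq = reverse (λ {a} {b} h → trans (sym′ b a) h) (reach p dp) ◅◅ reach q dq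

  glue : JCycle
  glue = record
    { edge = edge′ ; edge-sym = sym′ ; edge⊆K = ⊆J ; two-regular = two-regular′
    ; has-vertex = inj₁ a₀ , trans (L.degV-left a₀) (edge⇒deg2 A (trans (E-sym A _ x) xa₀))
    ; edge-connected = connected′ }

module _ {m n} (S : Joining m n) where
  open Joining S

  lift? : Cycle G → Maybe JCycle
  lift? C with two-reg C x
  ... | inj₁ avoids = just (Lift.lift S C avoids)
  ... | inj₂ _      = nothing

  is-just-lift? : ∀ C → is-just (lift? C) ≡ not (through x C)
  is-just-lift? C with two-reg C x
  ... | inj₁ d≡0 rewrite d≡0 = refl
  ... | inj₂ d≡2 rewrite d≡2 = refl

  lift?-left : ∀ C a a′ → maybe (λ D → edge D (inj₁ a) (inj₁ a′)) false (lift? C) ≡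
                           not (through x C) ∧ E C (punchIn x a) (punchIn x a′)
  lift?-left C a a′ with two-reg C x
  ... | inj₁ d≡0 rewrite d≡0 = refl
  ... | inj₂ d≡2 rewrite d≡2 = refl

  lift?-right : ∀ C p b → maybe (λ D → edge D p (inj₂ b)) false (lift? C) ≡ false
  lift?-right C p b with two-reg C x | p
  ... | inj₁ _ | inj₁ _ = refl
  ... | inj₁ _ | inj₂ _ = refl
  ... | inj₂ _ | _      = refl

  lift?-right′ : ∀ C b q → maybe (λ D → edge D (inj₂ b) q) false (lift? C) ≡ false
  lift?-right′ C b q with two-reg C x
  ... | inj₁ _ = refl
  ... | inj₂ _ = refl

-- The two bounds

module LowerBound {m n} (S : Joining m n) where
  open Joining S
  private
    module PG = Projection S
    module PH = Projection (swapJoining S)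

  projectsG : List JCycle → List (Cycle G)
  projectsG L = mapMaybe PG.project? L

  projectsH : List JCycle → List (Cycle H)
  projectsH L = mapMaybe PH.project? (map (swapCycle S) L)

  projectsG-CDC : ∀ L → IsCDCIn J L → IsCDC G (projectsG L)
  projectsG-CDC = PG.project-CDC

  projectsH-CDC : ∀ L → IsCDCIn J L → IsCDC H (projectsH L)
  projectsH-CDC L cdc = PH.project-CDC (map (swapCycle S) L) (swapCycle-CDC S L cdc)

  private
    touchesH : ∀ {C} → (∃ λ b → degV (edge C (inj₂ b)) ≡ 2) → PH.Touches (swapCycle S C)
    touchesH {C} (b , db) = b , trans (swapCycle-degV S C (inj₁ b)) db

  -- A cycle of the join projects to G, to H, or to both; the latter exactly when it crosses.
  touch-count : ∀ C → bit (does (PG.touches? C)) + bit (does (PH.touches? (swapCycle S C))) ≡ bit true + bit (PG.crosses C)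
  touch-count C with PG.touches? C | PH.touches? (swapCycle S C)
  ... | yes (a , da) | yes (b , db)
    rewrite PG.touches-both⇒crosses C da (trans (sym (swapCycle-degV S C (inj₁ b))) db) = refl
  ... | yes _   | no no-H rewrite ¬-not (no-H ∘ touchesH {C} ∘ proj₂ ∘ PG.crosses⇒touches-both C) = refl
  ... | no no-G | yes _   rewrite ¬-not (no-G ∘ proj₁ ∘ PG.crosses⇒touches-both C) = refl
  ... | no no-G | no no-H with has-vertex C
  ...   | inj₁ a , da = ⊥-elim (no-G (a , da))
  ...   | inj₂ b , db = ⊥-elim (no-H (touchesH {C} (b , db)))

  projects-length : ∀ L → IsCDCIn J L → length (projectsG L) + length (projectsH L) ≡ length L + 3
  projects-length L cdc = begin
    length (projectsG L) + length (projectsH L)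
      ≡⟨ cong₂ _+_ (trans (length-mapMaybe PG.project? L) (tally-cong PG.is-just-project? L))
                   (trans (length-mapMaybe PH.project? (map (swapCycle S) L))
                          (trans (tally-map _ (swapCycle S) L) (tally-cong (PH.is-just-project? ∘ swapCycle S) L))) ⟩
    tally (does ∘ PG.touches?) L + tally (λ C → does (PH.touches? (swapCycle S C))) L
      ≡⟨ tally-+ touch-count L ⟩
    tally (λ _ → true) L + tally PG.crosses L
      ≡⟨ cong₂ _+_ (sym (length≡tally L)) crossings ⟩
    length L + 3 ∎
    where
    crossings : tally PG.crosses L ≡ 3
    crossings = begin
      tally PG.crosses L                                ≡⟨ tally-cong PG.project?-through L ⟨
      tally (maybe (through x) false ∘ PG.project?) L   ≡⟨ tally-mapMaybe (through x) PG.project? L ⟨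
      tally (through x) (projectsG L)
        ≡⟨ Degree3Vertex.through-thrice (enumerate 3 (adj G x) deg-x) (projectsG L) (projectsG-CDC L cdc) ⟩
      3                                                 ∎

module Partners {m n} (S : Joining m n) {k} (nbrs : Enumeration (adj (Joining.G S) (Joining.x S)) k) where
  open Joining S
  open Enumeration nbrs renaming (elem to nbr; elem-∈ to nbr-adj; elem-injective to nbr-injective; elem-onto to nbr-onto)

  left : Fin k → Fin m
  left j = proj₁ (adj-punched G (nbr-adj j))

  left-spec : ∀ j → nbr j ≡ punchIn x (left j)
  left-spec j = proj₂ (adj-punched G (nbr-adj j))

  right : Fin k → Fin n
  right j = proj₁ (cross-totalˡ (left j) (subst (λ v → adj G x v ≡ true) (left-spec j) (nbr-adj j)))

  left-right : ∀ j → J (inj₁ (left j)) (inj₂ (right j)) ≡ true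
  left-right j = proj₂ (cross-totalˡ (left j) (subst (λ v → adj G x v ≡ true) (left-spec j) (nbr-adj j)))

  cross-index : ∀ a b → J (inj₁ a) (inj₂ b) ≡ true → ∃ λ j → a ≡ left j × b ≡ right j
  cross-index a b ab =
    let j , nbr≡ = nbr-onto (punchIn x a) (cross⇒adjˡ a b ab)
        a≡ = punchIn-injective x a (left j) (trans (sym nbr≡) (left-spec j))
    in j , a≡ , cross-functional (left j) b (right j) (subst (λ a → J (inj₁ a) (inj₂ b) ≡ true) a≡ ab) (left-right j)

  partners : Enumeration (adj H y) k
  partners = record
    { elem           = punchIn y ∘ right
    ; elem-∈         = λ j → cross⇒adjʳ _ _ (left-right j)
    ; elem-injective = injective
    ; elem-onto      = onto
    }
    where
    injective : ∀ {i j} → punchIn y (right i) ≡ punchIn y (right j) → i ≡ j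
    injective {i} {j} eq =
      let r≡ = punchIn-injective y _ _ eq
          l≡ = cross-injective (left i) (left j) (right j)
                 (subst (λ b → J (inj₁ (left i)) (inj₂ b) ≡ true) r≡ (left-right i)) (left-right j)
      in nbr-injective (trans (left-spec i) (trans (cong (punchIn x) l≡) (sym (left-spec j))))
    onto : ∀ w → adj H y w ≡ true → ∃ λ j → punchIn y (right j) ≡ w
    onto w yw with adj-punched H yw
    ... | b , refl = let a , ab = cross-totalʳ b yw
                         j , _ , b≡ = cross-index a b ab
                     in j , cong (punchIn y) (sym b≡)

module UpperBound {m n} (S : Joining m n) (nbrs : Enumeration (adj (Joining.G S) (Joining.x S)) 3)
                  (LG : List (Cycle (Joining.G S))) (cdcG : IsCDC (Joining.G S) LG)
                  (LH : List (Cycle (Joining.H S))) (cdcH : IsCDC (Joining.H S) LH) where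
  open Joining S
  private
    open Partners S nbrs
    module CG = Degree3Vertex {G = G} {x} nbrs
    module CH = Degree3Vertex {G = H} {y} partners

    A : Fin 3 → Cycle G
    A = CG.missing LG cdcG

    B : Fin 3 → Cycle H
    B = CH.missing LH cdcH

    cross-pattern : ∀ a b → J (inj₁ a) (inj₂ b) ≡ true → ∃ λ j → ∀ k →
                    E (A k) x (punchIn x a) ≡ not (does (j ≟ k)) × E (B k) y (punchIn y b) ≡ not (does (j ≟ k))
    cross-pattern a b ab = let j , a≡ , b≡ = cross-index a b ab in j , λ k →
      trans (cong (E (A k) x) (trans (cong (punchIn x) a≡) (sym (left-spec j)))) (CG.missing-at-x LG cdcG k j) ,
      trans (cong (E (B k) y ∘ punchIn y) b≡) (CH.missing-at-x LH cdcH k j)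

    matching : ∀ k → Matching S (A k) (B k)
    matching k a b ab = let j , pat = cross-pattern a b ab in trans (proj₁ (pat k)) (sym (proj₂ (pat k)))

    glued : Fin 3 → JCycle
    glued k = Glue.glue S (A k) (B k) (CG.missing-through LG cdcG k) (CH.missing-through LH cdcH k) (matching k)

  liftsG : List JCycle
  liftsG = mapMaybe (lift? S) LG

  liftsH : List (Joining.JCycle (swapJoining S))
  liftsH = mapMaybe (lift? (swapJoining S)) LH

  glueds : List JCycle
  glueds = List.tabulate glued

  cover : List JCycle
  cover = liftsG ++ map (unswapCycle S) liftsH ++ glueds

  private
    two-of-three : ∀ j → ∑[ k < 3 ] bit (not (does (j ≟ k)) ∧ not (does (j ≟ k))) ≡ 2
    two-of-three zero             = refl
    two-of-three (suc zero)       = refl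
    two-of-three (suc (suc zero)) = refl

    glued-cross : ∀ a b → J (inj₁ a) (inj₂ b) ≡ true →
                  ∑[ k < 3 ] bit (J (inj₁ a) (inj₂ b) ∧ (E (A k) x (punchIn x a) ∧ E (B k) y (punchIn y b))) ≡ 2
    glued-cross a b ab = let j , pat = cross-pattern a b ab in
      trans (sum-cong-≗ λ k → cong bit (cong₂ _∧_ ab (cong₂ _∧_ (proj₁ (pat k)) (proj₂ (pat k))))) (two-of-three j)

    glued-cross′ : ∀ a b → J (inj₁ a) (inj₂ b) ≡ true →
                   ∑[ k < 3 ] bit (J (inj₂ b) (inj₁ a) ∧ (E (B k) y (punchIn y b) ∧ E (A k) x (punchIn x a))) ≡ 2
    glued-cross′ a b ab = let j , pat = cross-pattern a b ab in
      trans (sum-cong-≗ λ k → cong bit (cong₂ _∧_ (trans (J-sym (inj₂ b) (inj₁ a)) ab) (cong₂ _∧_ (proj₂ (pat k)) (proj₁ (pat k)))))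
            (two-of-three j)

    fromG fromH fromGlued : V m n → V m n → ℕ
    fromG p q = tally (maybe (λ D → edge D p q) false ∘ lift? S) LG
    fromH p q = tally (maybe (λ D → edge D (swap p) (swap q)) false ∘ lift? (swapJoining S)) LH
    fromGlued p q = ∑[ k < 3 ] bit (edge (glued k) p q)

    count : ∀ p q → J p q ≡ true → fromG p q + (fromH p q + fromGlued p q) ≡ 2
    count (inj₁ a) (inj₁ a′) aa′ = begin
      fromG (inj₁ a) (inj₁ a′) + (fromH (inj₁ a) (inj₁ a′) + fromGlued (inj₁ a) (inj₁ a′))
        ≡⟨ cong₂ _+_ (tally-cong (λ C → lift?-left S C a a′) LG)
                     (cong (_+ fromGlued (inj₁ a) (inj₁ a′)) (tally-false (λ C → lift?-right′ (swapJoining S) C a (inj₂ a′)) LH)) ⟩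
      tally (λ C → not (through x C) ∧ E C (punchIn x a) (punchIn x a′)) LG + ∑[ k < 3 ] bit (E (A k) (punchIn x a) (punchIn x a′))
        ≡⟨ CG.tally-decompose LG cdcG (λ C → E C (punchIn x a) (punchIn x a′)) ⟨
      tally (λ C → E C (punchIn x a) (punchIn x a′)) LG
        ≡⟨ cdcG _ _ (trans (sym (J-left a a′)) aa′) ⟩
      2 ∎
    count (inj₂ b) (inj₂ b′) bb′ = begin
      fromG (inj₂ b) (inj₂ b′) + (fromH (inj₂ b) (inj₂ b′) + fromGlued (inj₂ b) (inj₂ b′))
        ≡⟨ cong₂ _+_ (tally-false (λ C → lift?-right′ S C b (inj₂ b′)) LG)
                     (cong (_+ fromGlued (inj₂ b) (inj₂ b′)) (tally-cong (λ C → lift?-left (swapJoining S) C b b′) LH)) ⟩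
      tally (λ C → not (through y C) ∧ E C (punchIn y b) (punchIn y b′)) LH + ∑[ k < 3 ] bit (E (B k) (punchIn y b) (punchIn y b′))
        ≡⟨ CH.tally-decompose LH cdcH (λ C → E C (punchIn y b) (punchIn y b′)) ⟨
      tally (λ C → E C (punchIn y b) (punchIn y b′)) LH
        ≡⟨ cdcH _ _ (trans (sym (J-right b b′)) bb′) ⟩
      2 ∎
    count (inj₁ a) (inj₂ b) ab =
      trans (cong₂ _+_ (tally-false (λ C → lift?-right S C (inj₁ a) b) LG)
                       (cong (_+ fromGlued (inj₁ a) (inj₂ b)) (tally-false (λ C → lift?-right′ (swapJoining S) C a (inj₁ b)) LH)))
            (glued-cross a b ab)
    count (inj₂ b) (inj₁ a) ba =
      trans (cong₂ _+_ (tally-false (λ C → lift?-right′ S C b (inj₁ a)) LG)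
                       (cong (_+ fromGlued (inj₂ b) (inj₁ a)) (tally-false (λ C → lift?-right (swapJoining S) C (inj₁ b) a) LH)))
            (glued-cross′ a b (trans (J-sym (inj₁ a) (inj₂ b)) ba))

  cover-CDC : IsCDCIn J cover
  cover-CDC p q pq = begin
    tally e cover
      ≡⟨ trans (tally-++ e liftsG _) (cong (tally e liftsG +_) (tally-++ e (map (unswapCycle S) liftsH) glueds)) ⟩
    tally e liftsG + (tally e (map (unswapCycle S) liftsH) + tally e glueds)
      ≡⟨ cong₂ _+_ (tally-mapMaybe e (lift? S) LG)
                   (cong₂ _+_ (trans (tally-map e (unswapCycle S) liftsH) (tally-mapMaybe _ (lift? (swapJoining S)) LH))
                              (tally-tabulate e glued)) ⟩
    fromG p q + (fromH p q + fromGlued p q)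
      ≡⟨ count p q pq ⟩
    2 ∎
    where
    e : JCycle → Bool
    e D = edge D p q

  cover-length : length cover + 3 ≡ length LG + length LH
  cover-length = begin
    length cover + 3
      ≡⟨ cong (_+ 3) (trans (length-++ liftsG) (cong (length liftsG +_) (length-++ (map (unswapCycle S) liftsH)))) ⟩
    (length liftsG + (length (map (unswapCycle S) liftsH) + length glueds)) + 3
      ≡⟨ cong (_+ 3) (cong₂ _+_ lifts-G (cong₂ _+_ (trans (length-map (unswapCycle S) liftsH) lifts-H) (length-tabulate glued))) ⟩
    (avoidG + (avoidH + 3)) + 3
      ≡⟨ +-assoc avoidG (avoidH + 3) 3 ⟩
    avoidG + ((avoidH + 3) + 3)
      ≡⟨ cong (avoidG +_) (+-comm (avoidH + 3) 3) ⟩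
    avoidG + (3 + (avoidH + 3))
      ≡⟨ +-assoc avoidG 3 (avoidH + 3) ⟨
    (avoidG + 3) + (avoidH + 3)
      ≡⟨ cong₂ _+_ (CG.length≡avoiding+3 LG cdcG) (CH.length≡avoiding+3 LH cdcH) ⟨
    length LG + length LH ∎
    where
    avoidG avoidH : ℕ
    avoidG = tally (not ∘ through x) LG
    avoidH = tally (not ∘ through y) LH
    lifts-G : length liftsG ≡ avoidG
    lifts-G = trans (length-mapMaybe (lift? S) LG) (tally-cong (is-just-lift? S) LG)
    lifts-H : length liftsH ≡ avoidH
    lifts-H = trans (length-mapMaybe (lift? (swapJoining S)) LH) (tally-cong (is-just-lift? (swapJoining S)) LH)

module JoinGraph {m n} (G : Graph (suc m)) (H : Graph (suc n)) (x : Fin (suc m)) (y : Fin (suc n))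
                 (f : Fin (suc m) → Fin (suc n)) (nbij : IsNbrBijection G H x y f)
                 (deg-x : deg (adj G x) ≡ 3) (deg-y : deg (adj H y) ≡ 3) where

  private
    maps-to : ∀ {a b} → cross G H x y f a b ≡ true → f (punchIn x a) ≡ punchIn y b
    maps-to {a} {b} h = does⇒ (f (punchIn x a) ≟ punchIn y b)
      (∧-conicalʳ (adj H y (punchIn y b)) _ (∧-conicalʳ (adj G x (punchIn x a)) _ h))

    cross-intro : ∀ {a b} → adj G x (punchIn x a) ≡ true → f (punchIn x a) ≡ punchIn y b → cross G H x y f a b ≡ true
    cross-intro {a} xa fa≡ =
      cong₂ _∧_ xa (cong₂ _∧_ (subst (λ w → adj H y w ≡ true) fa≡ (proj₁ nbij _ xa)) (dec-true (f (punchIn x a) ≟ _) fa≡))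

  joining : Joining m n
  joining = record
    { G = G ; H = H ; x = x ; y = y
    ; J                = adj⊎ G H x y f
    ; J-left           = λ _ _ → refl
    ; J-right          = λ _ _ → refl
    ; J-sym            = adj⊎-sym G H x y f
    ; cross⇒adjˡ       = λ _ _ h → ∧-conicalˡ _ _ h
    ; cross⇒adjʳ       = λ a b h → ∧-conicalˡ (adj H y (punchIn y b)) _ (∧-conicalʳ (adj G x (punchIn x a)) _ h)
    ; cross-functional = λ a b b′ h h′ → punchIn-injective y b b′ (trans (sym (maps-to h)) (maps-to h′))
    ; cross-injective  = λ a a′ b h h′ → punchIn-injective x a a′
        (proj₁ (proj₂ nbij) _ _ (∧-conicalˡ _ _ h) (∧-conicalˡ _ _ h′) (trans (maps-to h) (sym (maps-to h′))))
    ; cross-totalˡ     = λ a xa → let b , fa≡ = adj-punched H (proj₁ nbij _ xa) in b , cross-intro xa fa≡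
    ; cross-totalʳ     = λ b yb → let u , xu , fu≡ = proj₂ (proj₂ nbij) _ yb
                                      a , u≡ = adj-punched G xu
                                  in a , cross-intro (subst (λ v → adj G x v ≡ true) u≡ xu) (subst (λ v → f v ≡ _) u≡ fu≡)
    ; deg-x            = deg-x
    ; deg-y            = deg-y
    }

  G≡H : Graph (m + n)
  G≡H = join3 G H x y f

  private
    open Joining joining using (J; JCycle)

    J≡adj : ∀ p q → J p q ≡ adj G≡H (join m n p) (join m n q)
    J≡adj p q = sym (cong₂ (adj⊎ G H x y f) (splitAt-join m n p) (splitAt-join m n q))

    toJ : CycleIn deg (adj G≡H) → JCycle
    toJ = relabel (join-relabelling m n) J≡adj

    fromJ : JCycle → CycleIn deg (adj G≡H)
    fromJ = relabel (split-relabelling m n) (λ _ _ → refl)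

  lower : ∀ L → IsCDC G≡H L →
          Σ (List (Cycle G)) λ LG → IsCDC G LG ×
          Σ (List (Cycle H)) λ LH → IsCDC H LH × length LG + length LH ≡ length L + 3
  lower L cdc =
    let L′   = map toJ (map fromCycle L)
        cdc′ = relabel-CDC (join-relabelling m n) J≡adj (map fromCycle L) (fromCycle-CDC L cdc)
        open LowerBound joining
    in projectsG L′ , projectsG-CDC L′ cdc′ , projectsH L′ , projectsH-CDC L′ cdc′ ,
       trans (projects-length L′ cdc′) (cong (_+ 3) (trans (length-map toJ (map fromCycle L)) (length-map fromCycle L)))

  upper : ∀ LG → IsCDC G LG → ∀ LH → IsCDC H LH →
          Σ (List (Cycle G≡H)) λ L → IsCDC G≡H L × length L + 3 ≡ length LG + length LH
  upper LG cdcG LH cdcH =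
    let open UpperBound joining (enumerate 3 (adj G x) deg-x) LG cdcG LH cdcH
    in map toCycle (map fromJ cover) ,
       toCycle-CDC (map fromJ cover) (relabel-CDC (split-relabelling m n) (λ _ _ → refl) cover cover-CDC) ,
       trans (cong (_+ 3) (trans (length-map toCycle (map fromJ cover)) (length-map fromJ cover))) cover-length

lemma3 : ∀ {m n} (G : Graph (suc m)) (H : Graph (suc n)) → Cubic G → Cubic H →
         (x : Fin (suc m)) (y : Fin (suc n)) (f : Fin (suc m) → Fin (suc n)) →
         IsNbrBijection G H x y f →
         (cG cH : ℕ∞) → CDCNumber G cG → CDCNumber H cH →
         CDCNumber (join3 G H x y f) ((cG +∞ cH) ∸∞ 3)
lemma3 G H cubicG cubicH x y f nbij = c-join
  where
  open JoinGraph G H x y f nbij (cubicG x) (cubicH y)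
  c-join : ∀ cG cH → CDCNumber G cG → CDCNumber H cH → CDCNumber (join3 G H x y f) ((cG +∞ cH) ∸∞ 3)
  c-join nothing  _        no-G _    (L , cdc) = no-G (let LG , cdcG , _ = lower L cdc in LG , cdcG)
  c-join (just _) nothing  _    no-H (L , cdc) = no-H (let _ , _ , LH , cdcH , _ = lower L cdc in LH , cdcH)
  c-join (just _) (just _) ((LG , cdcG , refl) , minG) ((LH , cdcH , refl) , minH) =
    let L , cdc , len = upper LG cdcG LH cdcH
    in (L , cdc , trans (sym (m+n∸n≡m (length L) 3)) (cong (_∸ 3) len)) , minimal
    where
    minimal : ∀ L → IsCDC (join3 G H x y f) L → (length LG + length LH) ∸ 3 ≤ length L
    minimal L cdc =
      let LG′ , cdcG′ , LH′ , cdcH′ , len = lower L cdc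
      in m≤n+o⇒m∸n≤o _ 3 (≤-trans (+-mono-≤ (minG LG′ cdcG′) (minH LH′ cdcH′))
                                  (≤-reflexive (trans len (+-comm (length L) 3))))
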